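{- Let $q$ be a prime power. (i) If $n=4$ and $q\equiv3\pmod4$, then $N(Q,x^4-1,x^4-1)=N(Q,x^2-1,x^2-1)$. (ii) If $n=3$ and $q\equiv2\pmod3$, then $N(Q,x^3-1,x^3-1)=N(Q,x-1,x-1)$.
   Context: Let $F=GF(q)$, $E=GF(q^n)$, and $Q$ the radical of $\frac{q^n-1}{(q-1)\gcd(n,q-1)}$. For $m\mid q^n-1$, $w\in E^*$ is $m$-free if $w=v^d$ with $v\in E$, $d\mid m$ implies $d=1$. For monic $H=\sum a_ix^i\in F[x]$, $H^\sigma(v)=\sum a_iv^{q^i}$; for a monic divisor $g$ of $x^n-1$, $w\in E$ is $g$-free if $w=H^\sigma(v)$ with $v\in E$, $H$ a monic divisor of $g$, implies $H=1$. $N(m,g,h)$ is the number of $w\in E^*$ that are $m$-free and $g$-free with $w^{ -1}$ $h$-free. -}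

module Defs where

open import Level using (0ℓ)
open import Data.Nat as ℕ using (ℕ; zero; suc; _∸_; _≤?_)
open import Data.Nat.ListAction using (product)
open import Data.Nat.DivMod using (_/_)
open import Data.Nat.GCD using (gcd)
open import Data.Nat.Primality using (Prime; prime?)
open import Data.Nat.Divisibility using (_∣_; _∣?_)
open import Data.List as List using (List; []; _∷_; _++_; [_]; length; filter; upTo; replicate)
open import Data.List.Membership.Propositional using (_∈_)
open import Data.List.Relation.Unary.Unique.Propositional using (Unique)
open import Data.Vec as Vec using (Vec)
open import Data.Vec.Relation.Unary.All as VAll using ()
open import Data.Product using (Σ; _×_; ∃)
open import Relation.Nullary using (¬_; _×-dec_)
open import Relation.Binary.PropositionalEquality using (_≡_; _≢_)
open import Relation.Binary.Definitions using (DecidableEquality)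
open import Algebra.Structures using (IsCommutativeRing)
open import Function.Bundles using (_⇔_)

-- truncated division (division by 0 returns 0; never used at 0 here)
div' : ℕ → ℕ → ℕ
div' m zero    = 0
div' m (suc k) = m / suc k

radical : ℕ → ℕ
radical M = product (filter (λ p → prime? p ×-dec (p ∣? M)) (upTo (suc M)))

Qnum : ℕ → ℕ → ℕ
Qnum q n = radical (div' (q ℕ.^ n ∸ 1) ((q ∸ 1) ℕ.* gcd n (q ∸ 1)))

record FiniteField : Set₁ where
  field
    Carrier : Set
    _+_ _*_ : Carrier → Carrier → Carrier
    -_      : Carrier → Carrier
    0# 1#   : Carrier
    isCommutativeRing : IsCommutativeRing _≡_ _+_ _*_ -_ 0# 1#
    0≢1     : 0# ≢ 1#
    _⁻¹     : Carrier → Carrier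
    ⁻¹-inverse : ∀ x → x ≢ 0# → x * (x ⁻¹) ≡ 1#
    _≟_     : DecidableEquality Carrier
    elements : List Carrier
    elements-complete : ∀ x → x ∈ elements
    elements-unique   : Unique elements

  infixl 6 _+_
  infixl 7 _*_

  order : ℕ
  order = length elements

  _^_ : Carrier → ℕ → Carrier
  x ^ zero  = 1#
  x ^ suc k = x * (x ^ k)

-- Everything below is relative to E = GF(q^n) (a finite field with
-- q^n elements) and its subfield F = GF(q) = { a ∈ E | a^q = a }.

module _ (E : FiniteField) (q : ℕ) where
  open FiniteField E

  InF : Carrier → Set
  InF a = a ^ q ≡ a

  -- polynomials in E[x] as coefficient lists, lowest degree first
  Poly : Set
  Poly = List Carrier

  _+p_ : Poly → Poly → Poly
  []       +p bs       = bs
  (a ∷ as) +p []       = a ∷ as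
  (a ∷ as) +p (b ∷ bs) = (a + b) ∷ (as +p bs)

  _*p_ : Poly → Poly → Poly
  []       *p bs = []
  (a ∷ as) *p bs = List.map (a *_) bs +p (0# ∷ (as *p bs))

  monic : ∀ {d} → Vec Carrier d → Poly
  monic cs = Vec.toList cs ++ [ 1# ]

  MonicF : ∀ {d} → Vec Carrier d → Set
  MonicF cs = VAll.All InF cs

  xⁿ-1 : ℕ → Poly
  xⁿ-1 zero    = []      -- the zero polynomial; not used
  xⁿ-1 (suc k) = (- 1#) ∷ (replicate k 0# ++ [ 1# ])

  MonicDivides : ∀ {d} → Vec Carrier d → Poly → Set
  MonicDivides {d} cs g =
    Σ ℕ λ e → Σ (Vec Carrier e) λ ks → MonicF ks × (monic cs *p monic ks ≡ g)

  -- H^σ(v) = Σ_i a_i v^{q^i}  for H = x^d + Σ_{i<d} a_i x^i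
  σ-eval-from : ℕ → List Carrier → Carrier → Carrier
  σ-eval-from i []       v = 0#
  σ-eval-from i (a ∷ as) v = a * (v ^ (q ℕ.^ i)) + σ-eval-from (suc i) as v

  Hσ : ∀ {d} → Vec Carrier d → Carrier → Carrier
  Hσ cs v = σ-eval-from 0 (monic cs) v

  MFree : ℕ → Carrier → Set
  MFree m w = ∀ (d : ℕ) (v : Carrier) → d ∣ m → w ≡ v ^ d → d ≡ 1

  GFree : Poly → Carrier → Set
  GFree g w = ∀ (d : ℕ) (cs : Vec Carrier d) → MonicF cs → MonicDivides cs g →
              ∀ (v : Carrier) → w ≡ Hσ cs v → d ≡ 0

  NPred : ℕ → Poly → Poly → Carrier → Set
  NPred m g h w = (w ≢ 0#) × MFree m w × GFree g w × GFree h (w ⁻¹)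

  HasCount : (Carrier → Set) → ℕ → Set
  HasCount P k = Σ (List Carrier) λ xs →
    Unique xs × (∀ x → (x ∈ xs) ⇔ P x) × (length xs ≡ k)

  SameN : ℕ → Poly → Poly → ℕ → Poly → Poly → Set
  SameN m g h m' g' h' = ∃ λ k → HasCount (NPred m g h) k × HasCount (NPred m' g' h') k

IsPrimePower : ℕ → Set
IsPrimePower q = Σ ℕ λ p → Σ ℕ λ k → Prime p × (1 ℕ.≤ k) × (q ≡ p ℕ.^ k)

module Submission where

-- For q ≡ 3 (mod 4) the factor x² + 1 of x⁴ - 1 = (x - 1)(x + 1)(x² + 1) is
-- irreducible over F = GF(q), so a monic F-divisor H of x⁴ - 1 either divides
-- x² - 1 or is a multiple of x² + 1; in the second case every w = H^σ(v) has
-- w ^ q² = w (since v ^ q⁴ = v).  Q has a prime factor r coprime to q² - 1 (any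
-- prime factor of (q² + 1) / 2), and by Bézout every nonzero w with
-- w ^ (q² - 1) = 1 is then an r-th power, hence not Q-free.  So for a Q-free
-- w ≠ 0, and likewise for w⁻¹, being (x⁴ - 1)-free is the same as being
-- (x² - 1)-free, and the two counts coincide.  Part (ii) is the same argument
-- with x³ - 1 = (x - 1)(x² + x + 1), fixed points of w ↦ w ^ q and a prime
-- factor of q² + q + 1 not dividing q - 1.  The divisors H are classified by
-- comparing coefficients in H K = xⁿ - 1, degree by degree.

open import Defs

open import Level using (0ℓ)
open import Data.Nat as ℕ using (ℕ; zero; suc; _<_; _≤_; _⊔_; s≤s; z≤n; _!; _∸_)
import Data.Nat.Properties as ℕ
open import Data.Nat.Divisibility using (_∣_; _∣?_; divides; ∣-refl; ∣m⇒∣m*n; ∣n⇒∣m*n; ∣m+n∣m⇒∣n; ∣1⇒≡1; ∣⇒≤)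
open import Data.Nat.Primality using (Prime; euclidsLemma; prime⇒nonZero; prime⇒nonTrivial; ¬prime[0]; ¬prime[1])
open import Data.Nat.Combinatorics using (_C_; nCn≡1; nCk≡n!/k![n-k]!; k![n∸k]!∣n!)
open import Data.Nat.DivMod using (_/_; m*n/n≡m; m≡m%n+[m/n]*n; m∣n⇒o%n%m≡o%m; %-distribˡ-*)
open import Data.Nat.Coprimality using (Coprime; coprime-Bézout)
open import Data.Nat.GCD using (module Bézout)
open import Data.Fin as Fin using (Fin; toℕ; fromℕ; inject₁)
import Data.Fin.Properties as Fin
open import Data.Product using (∃; _×_; _,_; proj₁; proj₂)
open import Data.Product.Properties using () renaming (≡-dec to ×-≡-dec)
open import Data.Sum using (_⊎_; inj₁; inj₂; [_,_]′)
open import Data.Empty using (⊥-elim)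
open import Data.Maybe using (Maybe; just; nothing)
open import Data.List as List using (List; []; _∷_; [_]; map; filter; foldr; length; cartesianProductWith)
import Data.List.Properties as List
open import Data.List.Membership.Propositional using (_∈_; lose)
open import Data.List.Membership.Propositional.Properties
  using (∈-map⁺; ∈-map⁻; ∈-filter⁺; ∈-filter⁻; ∈-cartesianProductWith⁺)
open import Data.List.Membership.Propositional.Properties.WithK using (unique∧set⇒bag)
open import Data.List.Relation.Unary.Any as Any using (here; there)
open import Data.List.Relation.Unary.All as All using (All; []; _∷_)
import Data.List.Relation.Unary.All.Properties as All
open import Data.List.Relation.Unary.AllPairs using (_∷_)
open import Data.List.Relation.Unary.Unique.Propositional using (Unique)
import Data.List.Relation.Unary.Unique.Propositional.Properties as Unique
open import Data.List.Relation.Binary.Pointwise using ([]; _∷_; Pointwise-≡⇒≡)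
open import Data.List.Relation.Binary.Permutation.Propositional using (_↭_; ↭⇒↭ₛ)
open import Data.List.Relation.Binary.Permutation.Propositional.Properties using (↭-length)
import Data.List.Relation.Binary.Permutation.Setoid.Properties as PermutationSetoid
open import Data.List.Relation.Binary.BagAndSetEquality using (∼bag⇒↭)
open import Data.Vec as Vec using (Vec; []; _∷_)
import Data.Vec.Properties as Vec
open import Data.Vec.Relation.Unary.All as VecAll using ([]; _∷_)
import Data.Vec.Relation.Unary.All.Properties as VecAll
open import Function.Bundles using (_⇔_; mk⇔; Equivalence)
open import Relation.Nullary using (¬_; Dec; yes; no; ¬?; _×-dec_)
open import Relation.Nullary.Decidable using (_→-dec_; map′)
open import Relation.Binary.PropositionalEquality hiding ([_])
open import Algebra.Bundles using (CommutativeRing; Semiring; RawRing)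
open import Algebra.Solver.Ring.AlmostCommutativeRing using (fromCommutativeRing; _-Raw-AlmostCommutative⟶_)
import Algebra.Solver.Ring
import Algebra.Properties.Ring
import Algebra.Properties.CommutativeSemigroup
import Algebra.Properties.Semiring.Mult
import Algebra.Properties.Semiring.Mult.TCOptimised
import Algebra.Properties.Monoid.Sum
import Algebra.Properties.CommutativeSemiring.Binomial
import Algebra.Definitions.RawSemiring

prime>1 : ∀ {p} → Prime p → 1 < p
prime>1 {p} p-prime = ℕ.nonTrivial⇒n>1 p {{prime⇒nonTrivial p-prime}}

prime∤m! : ∀ {p} → Prime p → ∀ m → m < p → ¬ (p ∣ m !)
prime∤m! p-prime zero _ p∣1 = ℕ.<⇒≢ (prime>1 p-prime) (sym (∣1⇒≡1 p∣1))
prime∤m! p-prime (suc m) m<p p∣m! with euclidsLemma (suc m) (m !) p-prime p∣m!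
... | inj₁ p∣1+m = ℕ.<⇒≱ m<p (∣⇒≤ p∣1+m)
... | inj₂ p∣m!  = prime∤m! p-prime m (ℕ.<-trans (ℕ.n<1+n m) m<p) p∣m!

prime∣pCk : ∀ {p k} → Prime p → 0 < k → k < p → p ∣ p C k
prime∣pCk {p} {k} p-prime 0<k k<p with k![n∸k]!∣n! {p} {k} (ℕ.<⇒≤ k<p)
... | divides m p!≡m*k![p∸k]! = subst (p ∣_) (sym pCk≡m) p∣m
  where
  instance
    _ = ℕ._!*_!≢0 k (p ∸ k)
  pCk≡m : p C k ≡ m
  pCk≡m = trans (nCk≡n!/k![n-k]! (ℕ.<⇒≤ k<p))
                (trans (cong (_/ (k ! ℕ.* (p ∸ k) !)) p!≡m*k![p∸k]!) (m*n/n≡m m (k ! ℕ.* (p ∸ k) !)))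
  n∣n! : ∀ {n} → 0 < n → n ∣ n !
  n∣n! {suc n} _ = ∣m⇒∣m*n (n !) ∣-refl
  p∣m : p ∣ m
  p∣m with euclidsLemma m (k ! ℕ.* (p ∸ k) !) p-prime (subst (p ∣_) p!≡m*k![p∸k]! (n∣n! (ℕ.<-trans (s≤s z≤n) (prime>1 p-prime))))
  ... | inj₁ p∣m = p∣m
  ... | inj₂ p∣k![p∸k]! with euclidsLemma (k !) ((p ∸ k) !) p-prime p∣k![p∸k]!
  ...   | inj₁ p∣k! = ⊥-elim (prime∤m! p-prime k k<p p∣k!)
  ...   | inj₂ p∣[p∸k]! = ⊥-elim (prime∤m! p-prime (p ∸ k) (ℕ.∸-monoʳ-< 0<k (ℕ.<⇒≤ k<p)) p∣[p∸k]!)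

module IntegerCoefficientSolver (E : FiniteField) where
  open FiniteField E
  open ≡-Reasoning

  commutativeRing : CommutativeRing 0ℓ 0ℓ
  commutativeRing = record { isCommutativeRing = isCommutativeRing }

  open CommutativeRing commutativeRing
    using (ring; semiring; +-commutativeSemigroup; _-_; +-identityˡ; +-identityʳ; -‿inverseʳ; +-assoc)
  open Algebra.Properties.Ring ring
    using (-‿+-comm; ⁻¹-anti-homo‿-; x[y-z]≈xy-xz; [y-z]x≈yx-zx; -0#≈0#)
  open Algebra.Properties.CommutativeSemigroup +-commutativeSemigroup using (interchange)
  open Algebra.Properties.Semiring.Mult.TCOptimised semiring using (1+×; ×-homo-+; ×1-homo-*) renaming (_×_ to _×′_)

  -- The pair (m , n) stands for the integer m - n; the operations keep
  -- pairs normalised (m = 0 or n = 0), so that the solver's syntactic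
  -- comparison of coefficients is integer equality.
  ℤ² : Set
  ℤ² = ℕ × ℕ

  normalise : ℤ² → ℤ²
  normalise (m , n) = (m ℕ.∸ n , n ℕ.∸ m)

  ℤ²-rawRing : RawRing 0ℓ 0ℓ
  ℤ²-rawRing = record
    { Carrier = ℤ²
    ; _≈_ = _≡_
    ; _+_ = λ { (a , b) (c , d) → normalise (a ℕ.+ c , b ℕ.+ d) }
    ; _*_ = λ { (a , b) (c , d) → normalise (a ℕ.* c ℕ.+ b ℕ.* d , a ℕ.* d ℕ.+ b ℕ.* c) }
    ; -_ = λ { (a , b) → (b , a) }
    ; 0# = (0 , 0)
    ; 1# = (1 , 0)
    }

  -- Chosen so that the constants (0 , 0), (1 , 0) and (0 , 1) denote
  -- 0#, 1# and - 1# definitionally.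
  ⟦_⟧ : ℤ² → Carrier
  ⟦ m , zero ⟧ = m ×′ 1#
  ⟦ zero , suc n ⟧ = - (suc n ×′ 1#)
  ⟦ suc m , suc n ⟧ = ⟦ m , n ⟧

  ⟦⟧-normalise : ∀ x → ⟦ normalise x ⟧ ≡ ⟦ x ⟧
  ⟦⟧-normalise (zero , zero) = refl
  ⟦⟧-normalise (zero , suc n) = refl
  ⟦⟧-normalise (suc m , zero) = refl
  ⟦⟧-normalise (suc m , suc n) = ⟦⟧-normalise (m , n)

  ⟦⟧≡- : ∀ m n → ⟦ m , n ⟧ ≡ m ×′ 1# - n ×′ 1#
  ⟦⟧≡- m zero = sym (trans (cong (m ×′ 1# +_) -0#≈0#) (+-identityʳ _))
  ⟦⟧≡- zero (suc n) = sym (+-identityˡ _)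
  ⟦⟧≡- (suc m) (suc n) = begin
    ⟦ m , n ⟧                              ≡⟨ ⟦⟧≡- m n ⟩
    m ×′ 1# - n ×′ 1#                      ≡⟨ sym (+-identityˡ _) ⟩
    0# + (m ×′ 1# - n ×′ 1#)               ≡⟨ cong (_+ (m ×′ 1# - n ×′ 1#)) (sym (-‿inverseʳ 1#)) ⟩
    (1# - 1#) + (m ×′ 1# - n ×′ 1#)        ≡⟨ interchange 1# (- 1#) (m ×′ 1#) (- (n ×′ 1#)) ⟩
    (1# + m ×′ 1#) + (- 1# + - (n ×′ 1#))  ≡⟨ cong₂ _+_ (sym (1+× m 1#)) (-‿+-comm 1# (n ×′ 1#)) ⟩
    suc m ×′ 1# + - (1# + n ×′ 1#)         ≡⟨ cong (λ t → suc m ×′ 1# - t) (sym (1+× n 1#)) ⟩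
    suc m ×′ 1# - suc n ×′ 1# ∎

  ⟦⟧-+ : ∀ x y → ⟦ RawRing._+_ ℤ²-rawRing x y ⟧ ≡ ⟦ x ⟧ + ⟦ y ⟧
  ⟦⟧-+ (a , b) (c , d) = begin
    ⟦ normalise (a ℕ.+ c , b ℕ.+ d) ⟧  ≡⟨ ⟦⟧-normalise (a ℕ.+ c , b ℕ.+ d) ⟩
    ⟦ a ℕ.+ c , b ℕ.+ d ⟧              ≡⟨ ⟦⟧≡- (a ℕ.+ c) (b ℕ.+ d) ⟩
    (a ℕ.+ c) ×′ 1# - (b ℕ.+ d) ×′ 1#  ≡⟨ cong₂ _-_ (×-homo-+ 1# a c) (×-homo-+ 1# b d) ⟩
    (ιa + ιc) - (ιb + ιd)              ≡⟨ cong ((ιa + ιc) +_) (sym (-‿+-comm ιb ιd)) ⟩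
    (ιa + ιc) + (- ιb + - ιd)          ≡⟨ interchange ιa ιc (- ιb) (- ιd) ⟩
    (ιa - ιb) + (ιc - ιd)              ≡⟨ sym (cong₂ _+_ (⟦⟧≡- a b) (⟦⟧≡- c d)) ⟩
    ⟦ a , b ⟧ + ⟦ c , d ⟧ ∎
    where ιa = a ×′ 1#; ιb = b ×′ 1#; ιc = c ×′ 1#; ιd = d ×′ 1#

  ⟦⟧-* : ∀ x y → ⟦ RawRing._*_ ℤ²-rawRing x y ⟧ ≡ ⟦ x ⟧ * ⟦ y ⟧
  ⟦⟧-* (a , b) (c , d) = begin
    ⟦ normalise (a ℕ.* c ℕ.+ b ℕ.* d , a ℕ.* d ℕ.+ b ℕ.* c) ⟧
      ≡⟨ ⟦⟧-normalise (a ℕ.* c ℕ.+ b ℕ.* d , a ℕ.* d ℕ.+ b ℕ.* c) ⟩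
    ⟦ a ℕ.* c ℕ.+ b ℕ.* d , a ℕ.* d ℕ.+ b ℕ.* c ⟧
      ≡⟨ ⟦⟧≡- (a ℕ.* c ℕ.+ b ℕ.* d) (a ℕ.* d ℕ.+ b ℕ.* c) ⟩
    (a ℕ.* c ℕ.+ b ℕ.* d) ×′ 1# - (a ℕ.* d ℕ.+ b ℕ.* c) ×′ 1#
      ≡⟨ cong₂ _-_ (trans (×-homo-+ 1# (a ℕ.* c) (b ℕ.* d)) (cong₂ _+_ (×1-homo-* a c) (×1-homo-* b d)))
                   (trans (×-homo-+ 1# (a ℕ.* d) (b ℕ.* c)) (cong₂ _+_ (×1-homo-* a d) (×1-homo-* b c))) ⟩
    (ιa * ιc + ιb * ιd) - (ιa * ιd + ιb * ιc)
      ≡⟨ cong ((ιa * ιc + ιb * ιd) +_) (sym (-‿+-comm (ιa * ιd) (ιb * ιc))) ⟩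
    (ιa * ιc + ιb * ιd) + (- (ιa * ιd) + - (ιb * ιc))
      ≡⟨ interchange (ιa * ιc) (ιb * ιd) (- (ιa * ιd)) (- (ιb * ιc)) ⟩
    (ιa * ιc - ιa * ιd) + (ιb * ιd - ιb * ιc)
      ≡⟨ cong ((ιa * ιc - ιa * ιd) +_) (sym (⁻¹-anti-homo‿- (ιb * ιc) (ιb * ιd))) ⟩
    (ιa * ιc - ιa * ιd) - (ιb * ιc - ιb * ιd)
      ≡⟨ sym (cong₂ _-_ (x[y-z]≈xy-xz ιa ιc ιd) (x[y-z]≈xy-xz ιb ιc ιd)) ⟩
    ιa * (ιc - ιd) - ιb * (ιc - ιd)
      ≡⟨ sym ([y-z]x≈yx-zx (ιc - ιd) ιa ιb) ⟩
    (ιa - ιb) * (ιc - ιd)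
      ≡⟨ sym (cong₂ _*_ (⟦⟧≡- a b) (⟦⟧≡- c d)) ⟩
    ⟦ a , b ⟧ * ⟦ c , d ⟧ ∎
    where ιa = a ×′ 1#; ιb = b ×′ 1#; ιc = c ×′ 1#; ιd = d ×′ 1#

  ⟦⟧-neg : ∀ x → ⟦ RawRing.-_ ℤ²-rawRing x ⟧ ≡ - ⟦ x ⟧
  ⟦⟧-neg (a , b) = begin
    ⟦ b , a ⟧              ≡⟨ ⟦⟧≡- b a ⟩
    b ×′ 1# - a ×′ 1#      ≡⟨ sym (⁻¹-anti-homo‿- (a ×′ 1#) (b ×′ 1#)) ⟩
    - (a ×′ 1# - b ×′ 1#)  ≡⟨ cong -_ (sym (⟦⟧≡- a b)) ⟩
    - ⟦ a , b ⟧ ∎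

  ⟦⟧-morphism : ℤ²-rawRing -Raw-AlmostCommutative⟶ fromCommutativeRing commutativeRing
  ⟦⟧-morphism = record
    { ⟦_⟧ = ⟦_⟧ ; +-homo = ⟦⟧-+ ; *-homo = ⟦⟧-* ; -‿homo = ⟦⟧-neg ; 0-homo = refl ; 1-homo = refl }

  coefficient≟ : ∀ x y → Maybe (⟦ x ⟧ ≡ ⟦ y ⟧)
  coefficient≟ x y with ×-≡-dec ℕ._≟_ ℕ._≟_ x y
  ... | yes refl = just refl
  ... | no _ = nothing

  open Algebra.Solver.Ring ℤ²-rawRing (fromCommutativeRing commutativeRing) ⟦⟧-morphism coefficient≟ public
    using (solve; _:=_; _:+_; _:*_; :-_; _:-_; con; Polynomial)

  :0 :1 : ∀ {n} → Polynomial n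
  :0 = con (0 , 0)
  :1 = con (1 , 0)

module FiniteFieldTheory (E : FiniteField) where
  open FiniteField E
  open IntegerCoefficientSolver E public
    using (commutativeRing; solve; _:=_; _:+_; _:*_; :-_; _:-_; :0; :1)
  open CommutativeRing commutativeRing
    using (semiring; commutativeSemiring; +-isCommutativeMonoid; *-isCommutativeMonoid;
           +-identityˡ; +-identityʳ; *-identityˡ; *-identityʳ; *-assoc; *-comm; +-comm; +-assoc;
           -‿inverseˡ; -‿inverseʳ; zeroˡ; zeroʳ; _-_; ring)
  open Algebra.Properties.Ring ring using (x∙y⁻¹≈ε⇒x≈y; +-inverseˡ-unique)
  open Algebra.Properties.Semiring.Mult.TCOptimised semiring using (1+×; ×-homo-+; ×1-homo-*) renaming (_×_ to _×′_)
  open ≡-Reasoning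

  ^-distribˡ-+-* : ∀ x m n → x ^ (m ℕ.+ n) ≡ x ^ m * x ^ n
  ^-distribˡ-+-* x zero n = sym (*-identityˡ _)
  ^-distribˡ-+-* x (suc m) n = trans (cong (x *_) (^-distribˡ-+-* x m n)) (sym (*-assoc _ _ _))

  ^-distribʳ-* : ∀ x y n → (x * y) ^ n ≡ x ^ n * y ^ n
  ^-distribʳ-* x y zero = sym (*-identityˡ 1#)
  ^-distribʳ-* x y (suc n) = trans (cong ((x * y) *_) (^-distribʳ-* x y n))
    (solve 4 (λ x y xⁿ yⁿ → (x :* y) :* (xⁿ :* yⁿ) := (x :* xⁿ) :* (y :* yⁿ)) refl x y (x ^ n) (y ^ n))

  1^n≡1 : ∀ n → 1# ^ n ≡ 1#
  1^n≡1 zero = refl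
  1^n≡1 (suc n) = trans (*-identityˡ _) (1^n≡1 n)

  0^n≡0 : ∀ n → .{{ℕ.NonZero n}} → 0# ^ n ≡ 0#
  0^n≡0 (suc n) = zeroˡ _

  ^-*-assoc : ∀ x m n → (x ^ m) ^ n ≡ x ^ (m ℕ.* n)
  ^-*-assoc x zero n = 1^n≡1 n
  ^-*-assoc x (suc m) n = begin
    (x * x ^ m) ^ n          ≡⟨ ^-distribʳ-* x (x ^ m) n ⟩
    x ^ n * (x ^ m) ^ n      ≡⟨ cong (x ^ n *_) (^-*-assoc x m n) ⟩
    x ^ n * x ^ (m ℕ.* n)    ≡⟨ sym (^-distribˡ-+-* x n (m ℕ.* n)) ⟩
    x ^ (n ℕ.+ m ℕ.* n) ∎

  ^-% : ∀ {a} m k .{{_ : ℕ.NonZero m}} → a ^ m ≡ 1# → a ^ k ≡ a ^ (k ℕ.% m)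
  ^-% {a} m k aᵐ≡1 = begin
    a ^ k                                  ≡⟨ cong (a ^_) (m≡m%n+[m/n]*n k m) ⟩
    a ^ (k ℕ.% m ℕ.+ (k / m) ℕ.* m)        ≡⟨ ^-distribˡ-+-* a (k ℕ.% m) ((k / m) ℕ.* m) ⟩
    a ^ (k ℕ.% m) * a ^ ((k / m) ℕ.* m)    ≡⟨ cong (λ e → a ^ (k ℕ.% m) * a ^ e) (ℕ.*-comm (k / m) m) ⟩
    a ^ (k ℕ.% m) * a ^ (m ℕ.* (k / m))    ≡⟨ cong (a ^ (k ℕ.% m) *_) (sym (^-*-assoc a m (k / m))) ⟩
    a ^ (k ℕ.% m) * (a ^ m) ^ (k / m)      ≡⟨ cong (λ b → a ^ (k ℕ.% m) * b ^ (k / m)) aᵐ≡1 ⟩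
    a ^ (k ℕ.% m) * 1# ^ (k / m)           ≡⟨ cong (a ^ (k ℕ.% m) *_) (1^n≡1 (k / m)) ⟩
    a ^ (k ℕ.% m) * 1#                     ≡⟨ *-identityʳ _ ⟩
    a ^ (k ℕ.% m) ∎

  ⁻¹-inverseˡ : ∀ {x} → x ≢ 0# → x ⁻¹ * x ≡ 1#
  ⁻¹-inverseˡ {x} x≢0 = trans (*-comm _ _) (⁻¹-inverse x x≢0)

  *-cancelˡ : ∀ {x y z} → x ≢ 0# → x * y ≡ x * z → y ≡ z
  *-cancelˡ {x} {y} {z} x≢0 xy≡xz = begin
    y                 ≡⟨ sym (*-identityˡ y) ⟩
    1# * y            ≡⟨ cong (_* y) (sym (⁻¹-inverseˡ x≢0)) ⟩
    (x ⁻¹ * x) * y    ≡⟨ *-assoc _ _ _ ⟩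
    x ⁻¹ * (x * y)    ≡⟨ cong (x ⁻¹ *_) xy≡xz ⟩
    x ⁻¹ * (x * z)    ≡⟨ sym (*-assoc _ _ _) ⟩
    (x ⁻¹ * x) * z    ≡⟨ cong (_* z) (⁻¹-inverseˡ x≢0) ⟩
    1# * z            ≡⟨ *-identityˡ z ⟩
    z ∎

  x*y≡0⇒x≡0∨y≡0 : ∀ x {y} → x * y ≡ 0# → x ≡ 0# ⊎ y ≡ 0#
  x*y≡0⇒x≡0∨y≡0 x {y} xy≡0 with x ≟ 0#
  ... | yes x≡0 = inj₁ x≡0
  ... | no x≢0 = inj₂ (*-cancelˡ x≢0 (trans xy≡0 (sym (zeroʳ x))))

  *-nonzero : ∀ {x y} → x ≢ 0# → y ≢ 0# → x * y ≢ 0#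
  *-nonzero {x} x≢0 y≢0 xy≡0 with x*y≡0⇒x≡0∨y≡0 x xy≡0
  ... | inj₁ x≡0 = x≢0 x≡0
  ... | inj₂ y≡0 = y≢0 y≡0

  ^-nonzero : ∀ {x} n → x ≢ 0# → x ^ n ≢ 0#
  ^-nonzero zero x≢0 1≡0 = 0≢1 (sym 1≡0)
  ^-nonzero (suc n) x≢0 = *-nonzero x≢0 (^-nonzero n x≢0)

  ⁻¹-nonzero : ∀ {x} → x ≢ 0# → x ⁻¹ ≢ 0#
  ⁻¹-nonzero {x} x≢0 x⁻¹≡0 =
    0≢1 (trans (sym (zeroʳ x)) (trans (cong (x *_) (sym x⁻¹≡0)) (⁻¹-inverse x x≢0)))

  x*x≡1⇒x≡±1 : ∀ x → x * x ≡ 1# → x ≡ 1# ⊎ x ≡ - 1#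
  x*x≡1⇒x≡±1 x x²≡1 with x*y≡0⇒x≡0∨y≡0 (x - 1#) (begin
      (x - 1#) * (x + 1#)   ≡⟨ solve 1 (λ x → (x :- :1) :* (x :+ :1) := x :* x :- :1) refl x ⟩
      x * x - 1#            ≡⟨ cong (_- 1#) x²≡1 ⟩
      1# - 1#               ≡⟨ -‿inverseʳ 1# ⟩
      0# ∎)
  ... | inj₁ x-1≡0 = inj₁ (x∙y⁻¹≈ε⇒x≈y x 1# x-1≡0)
  ... | inj₂ x+1≡0 = inj₂ (+-inverseˡ-unique x 1# x+1≡0)

  ι : ℕ → Carrier
  ι n = n ×′ 1#

  ι-+ : ∀ m n → ι (m ℕ.+ n) ≡ ι m + ι n
  ι-+ = ×-homo-+ 1#

  ι-* : ∀ m n → ι (m ℕ.* n) ≡ ι m * ι n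
  ι-* = ×1-homo-*

  ι-^ : ∀ m n → ι (m ℕ.^ n) ≡ ι m ^ n
  ι-^ m zero = refl
  ι-^ m (suc n) = trans (ι-* m (m ℕ.^ n)) (cong (ι m *_) (ι-^ m n))

  Σₗ Πₗ : List Carrier → Carrier
  Σₗ = foldr _+_ 0#
  Πₗ = foldr _*_ 1#

  private
    module ↭-Properties = PermutationSetoid (setoid Carrier)

  Σ-↭ : ∀ {xs ys} → xs ↭ ys → Σₗ xs ≡ Σₗ ys
  Σ-↭ xs↭ys = ↭-Properties.foldr-commMonoid +-isCommutativeMonoid (↭⇒↭ₛ xs↭ys)

  Π-↭ : ∀ {xs ys} → xs ↭ ys → Πₗ xs ≡ Πₗ ys
  Π-↭ xs↭ys = ↭-Properties.foldr-commMonoid *-isCommutativeMonoid (↭⇒↭ₛ xs↭ys)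

  Σ-map-1+ : ∀ xs → Σₗ (map (1# +_) xs) ≡ ι (length xs) + Σₗ xs
  Σ-map-1+ [] = sym (+-identityʳ 0#)
  Σ-map-1+ (x ∷ xs) = begin
    (1# + x) + Σₗ (map (1# +_) xs)      ≡⟨ cong ((1# + x) +_) (Σ-map-1+ xs) ⟩
    (1# + x) + (ι (length xs) + Σₗ xs)  ≡⟨ solve 3 (λ x n s → (:1 :+ x) :+ (n :+ s) := (:1 :+ n) :+ (x :+ s)) refl x (ι (length xs)) (Σₗ xs) ⟩
    (1# + ι (length xs)) + (x + Σₗ xs)  ≡⟨ cong (_+ (x + Σₗ xs)) (sym (1+× (length xs) 1#)) ⟩
    ι (suc (length xs)) + Σₗ (x ∷ xs) ∎

  Π-map-* : ∀ a xs → Πₗ (map (a *_) xs) ≡ a ^ length xs * Πₗ xs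
  Π-map-* a [] = sym (*-identityˡ 1#)
  Π-map-* a (x ∷ xs) = begin
    (a * x) * Πₗ (map (a *_) xs)       ≡⟨ cong ((a * x) *_) (Π-map-* a xs) ⟩
    (a * x) * (a ^ length xs * Πₗ xs)  ≡⟨ solve 4 (λ a x aⁿ p → (a :* x) :* (aⁿ :* p) := (a :* aⁿ) :* (x :* p)) refl a x (a ^ length xs) (Πₗ xs) ⟩
    (a * a ^ length xs) * (x * Πₗ xs) ∎

  map-bijection-↭ : ∀ {xs} (f g : Carrier → Carrier) → Unique xs →
                    (∀ x → g (f x) ≡ x) → (∀ y → f (g y) ≡ y) →
                    (∀ {x} → x ∈ xs → f x ∈ xs) → (∀ {y} → y ∈ xs → g y ∈ xs) →
                    map f xs ↭ xs
  map-bijection-↭ {xs} f g xs! gf≗id fg≗id f-closed g-closed =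
    ∼bag⇒↭ (unique∧set⇒bag (Unique.map⁺ f-injective xs!) xs! (mk⇔ ⇒xs ⇒map))
    where
    f-injective : ∀ {x y} → f x ≡ f y → x ≡ y
    f-injective {x} {y} fx≡fy = trans (sym (gf≗id x)) (trans (cong g fx≡fy) (gf≗id y))
    ⇒xs : ∀ {y} → y ∈ map f xs → y ∈ xs
    ⇒xs y∈ with ∈-map⁻ f y∈
    ... | x , x∈xs , refl = f-closed x∈xs
    ⇒map : ∀ {y} → y ∈ xs → y ∈ map f xs
    ⇒map {y} y∈xs = subst (_∈ map f xs) (fg≗id y) (∈-map⁺ f (g-closed y∈xs))

  ι-order≡0 : ι order ≡ 0#
  ι-order≡0 = begin
    ι order                                ≡⟨ sym (+-identityʳ _) ⟩
    ι order + 0#                           ≡⟨ cong (ι order +_) (sym (-‿inverseʳ (Σₗ elements))) ⟩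
    ι order + (Σₗ elements - Σₗ elements)  ≡⟨ sym (+-assoc _ _ _) ⟩
    (ι order + Σₗ elements) - Σₗ elements  ≡⟨ cong (_- Σₗ elements) (sym (Σ-map-1+ elements)) ⟩
    Σₗ (map (1# +_) elements) - Σₗ elements ≡⟨ cong (_- Σₗ elements) (Σ-↭ shift-↭) ⟩
    Σₗ elements - Σₗ elements              ≡⟨ -‿inverseʳ _ ⟩
    0# ∎
    where
    shift-↭ : map (1# +_) elements ↭ elements
    shift-↭ = map-bijection-↭ (1# +_) (- 1# +_) elements-unique
      (λ x → solve 1 (λ x → :- :1 :+ (:1 :+ x) := x) refl x)
      (λ y → solve 1 (λ y → :1 :+ (:- :1 :+ y) := y) refl y)
      (λ {x} _ → elements-complete _) (λ {y} _ → elements-complete _)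

  odd-order⇒1+1≢0 : order ℕ.% 2 ≡ 1 → 1# + 1# ≢ 0#
  odd-order⇒1+1≢0 order%2≡1 1+1≡0 = 0≢1 (begin
    0#                                  ≡⟨ sym ι-order≡0 ⟩
    ι order                             ≡⟨ cong ι (trans (m≡m%n+[m/n]*n order 2) (cong (ℕ._+ t ℕ.* 2) order%2≡1)) ⟩
    ι (1 ℕ.+ t ℕ.* 2)                   ≡⟨ trans (ι-+ 1 (t ℕ.* 2)) (cong (1# +_) (ι-* t 2)) ⟩
    1# + ι t * (1# + 1#)                ≡⟨ cong (λ s → 1# + ι t * s) 1+1≡0 ⟩
    1# + ι t * 0#                       ≡⟨ trans (cong (1# +_) (zeroʳ (ι t))) (+-identityʳ 1#) ⟩
    1# ∎)
    where t = order / 2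


  nonzeros : List Carrier
  nonzeros = filter (λ x → ¬? (x ≟ 0#)) elements

  private
    nonzeros-nonzero : All (_≢ 0#) nonzeros
    nonzeros-nonzero = All.all-filter (λ x → ¬? (x ≟ 0#)) elements

    nonzeros-unique : Unique nonzeros
    nonzeros-unique = Unique.filter⁺ (λ x → ¬? (x ≟ 0#)) elements-unique

    ∈-nonzeros : ∀ {x} → x ≢ 0# → x ∈ nonzeros
    ∈-nonzeros x≢0 = ∈-filter⁺ (λ x → ¬? (x ≟ 0#)) (elements-complete _) x≢0

    ∈-nonzeros⁻ : ∀ {x} → x ∈ nonzeros → x ≢ 0#
    ∈-nonzeros⁻ x∈ = proj₂ (∈-filter⁻ (λ x → ¬? (x ≟ 0#)) {xs = elements} x∈)

  order≡1+|nonzeros| : order ≡ suc (length nonzeros)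
  order≡1+|nonzeros| = ↭-length (∼bag⇒↭ (unique∧set⇒bag elements-unique 0∷nonzeros-unique (mk⇔ ⇒0∷ (λ _ → elements-complete _))))
    where
    0∷nonzeros-unique : Unique (0# ∷ nonzeros)
    0∷nonzeros-unique = All.map (λ x≢0 0≡x → x≢0 (sym 0≡x)) nonzeros-nonzero ∷ nonzeros-unique
    ⇒0∷ : ∀ {x} → x ∈ elements → x ∈ 0# ∷ nonzeros
    ⇒0∷ {x} _ with x ≟ 0#
    ... | yes x≡0 = here x≡0
    ... | no x≢0 = there (∈-nonzeros x≢0)

  Π-nonzero : ∀ {xs} → All (_≢ 0#) xs → Πₗ xs ≢ 0#
  Π-nonzero [] 1≡0 = 0≢1 (sym 1≡0)
  Π-nonzero (x≢0 ∷ xs≢0) = *-nonzero x≢0 (Π-nonzero xs≢0)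

  -- Multiplication by a ≠ 0 permutes the nonzero elements.
  ^-|nonzeros|≡1 : ∀ {a} → a ≢ 0# → a ^ length nonzeros ≡ 1#
  ^-|nonzeros|≡1 {a} a≢0 = sym (*-cancelˡ (Π-nonzero nonzeros-nonzero) (begin
    Πₗ nonzeros * 1#                     ≡⟨ *-identityʳ _ ⟩
    Πₗ nonzeros                          ≡⟨ Π-↭ (map-bijection-↭ (a *_) (a ⁻¹ *_) nonzeros-unique a⁻¹a aa⁻¹ a*-closed a⁻¹*-closed) ⟨
    Πₗ (map (a *_) nonzeros)             ≡⟨ Π-map-* a nonzeros ⟩
    a ^ length nonzeros * Πₗ nonzeros    ≡⟨ *-comm _ _ ⟩
    Πₗ nonzeros * a ^ length nonzeros ∎))
    where
    a⁻¹a : ∀ x → a ⁻¹ * (a * x) ≡ x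
    a⁻¹a x = trans (sym (*-assoc _ _ _)) (trans (cong (_* x) (⁻¹-inverseˡ a≢0)) (*-identityˡ x))
    aa⁻¹ : ∀ x → a * (a ⁻¹ * x) ≡ x
    aa⁻¹ x = trans (sym (*-assoc _ _ _)) (trans (cong (_* x) (⁻¹-inverse a a≢0)) (*-identityˡ x))
    a*-closed : ∀ {x} → x ∈ nonzeros → a * x ∈ nonzeros
    a*-closed x∈ = ∈-nonzeros (*-nonzero a≢0 (∈-nonzeros⁻ x∈))
    a⁻¹*-closed : ∀ {x} → x ∈ nonzeros → a ⁻¹ * x ∈ nonzeros
    a⁻¹*-closed x∈ = ∈-nonzeros (*-nonzero (⁻¹-nonzero a≢0) (∈-nonzeros⁻ x∈))

  fermat : ∀ x → x ^ order ≡ x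
  fermat x rewrite order≡1+|nonzeros| with x ≟ 0#
  ... | yes refl = zeroˡ _
  ... | no x≢0 = trans (cong (x *_) (^-|nonzeros|≡1 x≢0)) (*-identityʳ x)

  private
    open Algebra.Definitions.RawSemiring (Semiring.rawSemiring semiring)
      using () renaming (_^_ to _^ₛ_; _×_ to _×ᵤ_)
    open Algebra.Properties.Semiring.Mult semiring using (×-assoc-*)
    open Algebra.Properties.Monoid.Sum (CommutativeRing.+-monoid commutativeRing)
      using (sum; sum-init-last; sum-cong-≗; sum-replicate-zero)
    module Binomial = Algebra.Properties.CommutativeSemiring.Binomial commutativeSemiring

    ^ₛ≡^ : ∀ x n → x ^ₛ n ≡ x ^ n
    ^ₛ≡^ x zero = refl
    ^ₛ≡^ x (suc n) = cong (x *_) (^ₛ≡^ x n)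

    1×ᵤ : ∀ z → 1 ×ᵤ z ≡ z
    1×ᵤ z = +-identityʳ z

    ×ᵤ≡ι* : ∀ n z → n ×ᵤ z ≡ ι n * z
    ×ᵤ≡ι* n z = begin
      n ×ᵤ z            ≡⟨ cong (n ×ᵤ_) (sym (*-identityˡ z)) ⟩
      n ×ᵤ (1# * z)     ≡⟨ sym (×-assoc-* n 1# z) ⟩
      (n ×ᵤ 1#) * z     ≡⟨ cong (_* z) (Algebra.Properties.Semiring.Mult.TCOptimised.×ᵤ≈× semiring n 1#) ⟩
      ι n * z ∎

  frobenius : ∀ {p} → Prime p → ι p ≡ 0# → ∀ x y → (x + y) ^ p ≡ x ^ p + y ^ p
  frobenius {0} p-prime = ⊥-elim (¬prime[0] p-prime)
  frobenius {1} p-prime = ⊥-elim (¬prime[1] p-prime)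
  frobenius {p@(suc (suc r))} p-prime ιp≡0 x y = begin
    (x + y) ^ p
      ≡⟨ sym (^ₛ≡^ (x + y) p) ⟩
    (x + y) ^ₛ p
      ≡⟨ Binomial.theorem p x y ⟩
    f Fin.zero + sum (λ i → f (Fin.suc i))
      ≡⟨ cong (f Fin.zero +_) (sum-init-last (λ i → f (Fin.suc i))) ⟩
    f Fin.zero + (sum (λ i → f (Fin.suc (inject₁ i))) + f (fromℕ p))
      ≡⟨ cong (λ s → f Fin.zero + (s + f (fromℕ p))) (trans (sum-cong-≗ inner-term≡0) (sum-replicate-zero (suc r))) ⟩
    f Fin.zero + (0# + f (fromℕ p))
      ≡⟨ cong₂ (λ s t → s + (0# + t)) first-term last-term ⟩
    y ^ p + (0# + x ^ p)
      ≡⟨ solve 2 (λ X Y → Y :+ (:0 :+ X) := X :+ Y) refl (x ^ p) (y ^ p) ⟩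
    x ^ p + y ^ p ∎
    where
    f = Binomial.binomialTerm x y p
    inner-term≡0 : ∀ (i : Fin (suc r)) → f (Fin.suc (inject₁ i)) ≡ 0#
    inner-term≡0 i with prime∣pCk p-prime (s≤s z≤n) (s≤s (s≤s (subst (_≤ r) (sym (Fin.toℕ-inject₁ i)) (ℕ.≤-pred (Fin.toℕ<n i)))))
    ... | divides m pCk≡m*p = begin
      (p C k) ×ᵤ b          ≡⟨ ×ᵤ≡ι* (p C k) b ⟩
      ι (p C k) * b         ≡⟨ cong (λ n → ι n * b) pCk≡m*p ⟩
      ι (m ℕ.* p) * b       ≡⟨ cong (_* b) (trans (ι-* m p) (trans (cong (ι m *_) ιp≡0) (zeroʳ (ι m)))) ⟩
      0# * b                ≡⟨ zeroˡ b ⟩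
      0# ∎
      where
      k = suc (toℕ (inject₁ i))
      b = Binomial.binomial x y p (Fin.suc (inject₁ i))
    first-term : f Fin.zero ≡ y ^ p
    first-term = trans (1×ᵤ _) (trans (*-identityˡ _) (^ₛ≡^ y p))
    last-term : f (fromℕ p) ≡ x ^ p
    last-term = term-p (toℕ (fromℕ p)) (Fin.toℕ-fromℕ p)
      where
      term-p : ∀ k → k ≡ p → (p C k) ×ᵤ (x ^ₛ k * y ^ₛ (p ∸ k)) ≡ x ^ p
      term-p _ refl = begin
        (p C p) ×ᵤ (x ^ₛ p * y ^ₛ (p ∸ p))   ≡⟨ cong₂ (λ c e → c ×ᵤ (x ^ₛ p * y ^ₛ e)) (nCn≡1 p) (ℕ.n∸n≡0 p) ⟩
        1 ×ᵤ (x ^ₛ p * 1#)                   ≡⟨ trans (1×ᵤ _) (*-identityʳ _) ⟩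
        x ^ₛ p                               ≡⟨ ^ₛ≡^ x p ⟩
        x ^ p ∎

module Extension (E : FiniteField) (q : ℕ) {p k : ℕ} (p-prime : Prime p) (q≡pᵏ : q ≡ p ℕ.^ k)
                 (n : ℕ) (order≡qⁿ : FiniteField.order E ≡ q ℕ.^ n) where
  open FiniteField E
  open FiniteFieldTheory E
  open CommutativeRing commutativeRing using (+-identityʳ; *-identityʳ; *-identityˡ; -‿inverseʳ; ring)
  open Algebra.Properties.Ring ring using (+-inverseʳ-unique)
  open ≡-Reasoning

  qⁱ≢0 : ∀ i → ℕ.NonZero (q ℕ.^ i)
  qⁱ≢0 i rewrite q≡pᵏ = ℕ.m^n≢0 (p ℕ.^ k) i {{ℕ.m^n≢0 p k {{prime⇒nonZero p-prime}}}}

  qⁱ≡p^[k*i] : ∀ i → q ℕ.^ i ≡ p ℕ.^ (k ℕ.* i)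
  qⁱ≡p^[k*i] i = trans (cong (ℕ._^ i) q≡pᵏ) (ℕ.^-*-assoc p k i)

  ι-p≡0 : ι p ≡ 0#
  ι-p≡0 with ι p ≟ 0#
  ... | yes ιp≡0 = ιp≡0
  ... | no ιp≢0 = ⊥-elim (^-nonzero (k ℕ.* n) ιp≢0 (begin
    ι p ^ (k ℕ.* n)        ≡⟨ sym (ι-^ p (k ℕ.* n)) ⟩
    ι (p ℕ.^ (k ℕ.* n))    ≡⟨ cong ι (sym (trans order≡qⁿ (qⁱ≡p^[k*i] n))) ⟩
    ι order                ≡⟨ ι-order≡0 ⟩
    0# ∎))

  frobenius-pʲ : ∀ j x y → (x + y) ^ (p ℕ.^ j) ≡ x ^ (p ℕ.^ j) + y ^ (p ℕ.^ j)
  frobenius-pʲ zero x y = trans (*-identityʳ _) (sym (cong₂ _+_ (*-identityʳ x) (*-identityʳ y)))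
  frobenius-pʲ (suc j) x y = begin
    (x + y) ^ (p ℕ.* p ℕ.^ j)                  ≡⟨ sym (^-*-assoc (x + y) p (p ℕ.^ j)) ⟩
    ((x + y) ^ p) ^ (p ℕ.^ j)                  ≡⟨ cong (_^ (p ℕ.^ j)) (frobenius p-prime ι-p≡0 x y) ⟩
    (x ^ p + y ^ p) ^ (p ℕ.^ j)                ≡⟨ frobenius-pʲ j (x ^ p) (y ^ p) ⟩
    (x ^ p) ^ (p ℕ.^ j) + (y ^ p) ^ (p ℕ.^ j)  ≡⟨ cong₂ _+_ (^-*-assoc x p (p ℕ.^ j)) (^-*-assoc y p (p ℕ.^ j)) ⟩
    x ^ (p ℕ.* p ℕ.^ j) + y ^ (p ℕ.* p ℕ.^ j) ∎

  frobenius-qⁱ : ∀ i x y → (x + y) ^ (q ℕ.^ i) ≡ x ^ (q ℕ.^ i) + y ^ (q ℕ.^ i)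
  frobenius-qⁱ i x y rewrite qⁱ≡p^[k*i] i = frobenius-pʲ (k ℕ.* i) x y

  qᵃ∘qᵇ : ∀ v a b → (v ^ (q ℕ.^ a)) ^ (q ℕ.^ b) ≡ v ^ (q ℕ.^ (a ℕ.+ b))
  qᵃ∘qᵇ v a b = trans (^-*-assoc v (q ℕ.^ a) (q ℕ.^ b)) (cong (v ^_) (sym (ℕ.^-distribˡ-+-* q a b)))

  fermat-qⁿ : ∀ v → v ^ (q ℕ.^ n) ≡ v
  fermat-qⁿ v = trans (cong (v ^_) (sym order≡qⁿ)) (fermat v)

  fermat-qⁿ⁺ⁱ : ∀ v i → v ^ (q ℕ.^ (n ℕ.+ i)) ≡ v ^ (q ℕ.^ i)
  fermat-qⁿ⁺ⁱ v i = trans (sym (qᵃ∘qᵇ v n i)) (cong (_^ (q ℕ.^ i)) (fermat-qⁿ v))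

  0∈F : InF E q 0#
  0∈F = trans (cong (0# ^_) (sym (ℕ.*-identityʳ q))) (0^n≡0 (q ℕ.^ 1) {{qⁱ≢0 1}})

  1∈F : InF E q 1#
  1∈F = 1^n≡1 q

  InF-qⁱ : ∀ {a} → InF E q a → ∀ i → a ^ (q ℕ.^ i) ≡ a
  InF-qⁱ {a} a∈F zero = *-identityʳ a
  InF-qⁱ {a} a∈F (suc i) = begin
    a ^ (q ℕ.* q ℕ.^ i)     ≡⟨ sym (^-*-assoc a q (q ℕ.^ i)) ⟩
    (a ^ q) ^ (q ℕ.^ i)     ≡⟨ cong (_^ (q ℕ.^ i)) a∈F ⟩
    a ^ (q ℕ.^ i)           ≡⟨ InF-qⁱ a∈F i ⟩
    a ∎

  -‿frobenius-qⁱ : ∀ i x → (- x) ^ (q ℕ.^ i) ≡ - (x ^ (q ℕ.^ i))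
  -‿frobenius-qⁱ i x = +-inverseʳ-unique (x ^ (q ℕ.^ i)) ((- x) ^ (q ℕ.^ i)) (begin
    x ^ (q ℕ.^ i) + (- x) ^ (q ℕ.^ i)   ≡⟨ sym (frobenius-qⁱ i x (- x)) ⟩
    (x + - x) ^ (q ℕ.^ i)               ≡⟨ cong (_^ (q ℕ.^ i)) (-‿inverseʳ x) ⟩
    0# ^ (q ℕ.^ i)                      ≡⟨ 0^n≡0 (q ℕ.^ i) {{qⁱ≢0 i}} ⟩
    0# ∎)

  -‿∈F : ∀ {a} → InF E q a → InF E q (- a)
  -‿∈F {a} a∈F = begin
    (- a) ^ q             ≡⟨ cong ((- a) ^_) (sym (ℕ.*-identityʳ q)) ⟩
    (- a) ^ (q ℕ.^ 1)     ≡⟨ -‿frobenius-qⁱ 1 a ⟩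
    - (a ^ (q ℕ.^ 1))     ≡⟨ cong -_ (InF-qⁱ a∈F 1) ⟩
    - a ∎

  σ-eval-frobenius : ∀ j i (as : List Carrier) → All (InF E q) as → ∀ v →
                     σ-eval-from E q i as v ^ (q ℕ.^ j) ≡ σ-eval-from E q (j ℕ.+ i) as v
  σ-eval-frobenius j i [] [] v = 0^n≡0 (q ℕ.^ j) {{qⁱ≢0 j}}
  σ-eval-frobenius j i (a ∷ as) (a∈F ∷ as∈F) v = begin
    (a * v ^ (q ℕ.^ i) + σ-eval-from E q (suc i) as v) ^ (q ℕ.^ j)
      ≡⟨ frobenius-qⁱ j _ _ ⟩
    (a * v ^ (q ℕ.^ i)) ^ (q ℕ.^ j) + σ-eval-from E q (suc i) as v ^ (q ℕ.^ j)
      ≡⟨ cong₂ _+_ (^-distribʳ-* a _ (q ℕ.^ j)) (σ-eval-frobenius j (suc i) as as∈F v) ⟩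
    a ^ (q ℕ.^ j) * (v ^ (q ℕ.^ i)) ^ (q ℕ.^ j) + σ-eval-from E q (j ℕ.+ suc i) as v
      ≡⟨ cong₂ (λ b t → b * t + σ-eval-from E q (j ℕ.+ suc i) as v)
               (InF-qⁱ a∈F j) (trans (qᵃ∘qᵇ v i j) (cong (λ e → v ^ (q ℕ.^ e)) (ℕ.+-comm i j))) ⟩
    a * v ^ (q ℕ.^ (j ℕ.+ i)) + σ-eval-from E q (j ℕ.+ suc i) as v
      ≡⟨ cong (λ e → a * v ^ (q ℕ.^ (j ℕ.+ i)) + σ-eval-from E q e as v) (ℕ.+-suc j i) ⟩
    a * v ^ (q ℕ.^ (j ℕ.+ i)) + σ-eval-from E q (suc (j ℕ.+ i)) as v ∎

  Hσ-frobenius : ∀ j {d} (cs : Vec Carrier d) → MonicF E q cs → ∀ v →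
                 Hσ E q cs v ^ (q ℕ.^ j) ≡ σ-eval-from E q j (monic E q cs) v
  Hσ-frobenius j cs cs∈F v =
    trans (σ-eval-frobenius j 0 (monic E q cs) (All.++⁺ (VecAll.toList⁺ cs∈F) (1∈F ∷ [])) v)
          (cong (λ e → σ-eval-from E q e (monic E q cs) v) (ℕ.+-identityʳ j))

module Polynomials (E : FiniteField) (q : ℕ) where
  open FiniteField E
  open ≡-Reasoning

  coefficient : ℕ → Poly E q → Carrier
  coefficient _ [] = 0#
  coefficient zero (a ∷ _) = a
  coefficient (suc i) (_ ∷ as) = coefficient i as

  length-+p : ∀ (as bs : Poly E q) → length (_+p_ E q as bs) ≡ length as ⊔ length bs
  length-+p [] bs = refl
  length-+p (a ∷ as) [] = refl
  length-+p (a ∷ as) (b ∷ bs) = cong suc (length-+p as bs)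

  length-*p : ∀ x xs y ys → length (_*p_ E q (x ∷ xs) (y ∷ ys)) ≡ suc (length xs ℕ.+ length ys)
  length-*p x [] y ys = begin
    length (_+p_ E q (map (x *_) (y ∷ ys)) [ 0# ])     ≡⟨ length-+p (map (x *_) (y ∷ ys)) [ 0# ] ⟩
    length (map (x *_) (y ∷ ys)) ⊔ 1                 ≡⟨ cong (_⊔ 1) (List.length-map (x *_) (y ∷ ys)) ⟩
    suc (length ys) ⊔ 1                              ≡⟨ ℕ.m≥n⇒m⊔n≡m (s≤s z≤n) ⟩
    suc (length ys) ∎
  length-*p x (x′ ∷ xs) y ys = begin
    length (_+p_ E q (map (x *_) (y ∷ ys)) (0# ∷ _*p_ E q (x′ ∷ xs) (y ∷ ys)))
      ≡⟨ length-+p (map (x *_) (y ∷ ys)) (0# ∷ _*p_ E q (x′ ∷ xs) (y ∷ ys)) ⟩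
    length (map (x *_) (y ∷ ys)) ⊔ suc (length (_*p_ E q (x′ ∷ xs) (y ∷ ys)))
      ≡⟨ cong₂ _⊔_ (List.length-map (x *_) (y ∷ ys)) (cong suc (length-*p x′ xs y ys)) ⟩
    suc (length ys) ⊔ suc (suc (length xs ℕ.+ length ys))
      ≡⟨ ℕ.m≤n⇒m⊔n≡n (s≤s (ℕ.m≤n+m (length ys) (suc (length xs)))) ⟩
    suc (suc (length xs ℕ.+ length ys)) ∎

  length-monic : ∀ {d} (cs : Vec Carrier d) → length (monic E q cs) ≡ suc d
  length-monic {d} cs = trans (List.length-++ (Vec.toList cs)) (trans (cong (ℕ._+ 1) (Vec.length-toList cs)) (ℕ.+-comm d 1))

  length-monic-*p : ∀ {d e} (cs : Vec Carrier d) (ks : Vec Carrier e) →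
                    length (_*p_ E q (monic E q cs) (monic E q ks)) ≡ suc (d ℕ.+ e)
  length-monic-*p cs ks = go (monic E q cs) (monic E q ks) (length-monic cs) (length-monic ks)
    where
    go : ∀ {d e} xs ys → length xs ≡ suc d → length ys ≡ suc e → length (_*p_ E q xs ys) ≡ suc (d ℕ.+ e)
    go (x ∷ xs) (y ∷ ys) refl refl = length-*p x xs y ys

  degrees-of-factors : ∀ {d e} (cs : Vec Carrier d) (ks : Vec Carrier e) {g} →
                       _*p_ E q (monic E q cs) (monic E q ks) ≡ g → suc (d ℕ.+ e) ≡ length g
  degrees-of-factors cs ks refl = sym (length-monic-*p cs ks)

  cofactor-degree< : ∀ {d e} (cs : Vec Carrier d) (ks : Vec Carrier e) {g} →
                     _*p_ E q (monic E q cs) (monic E q ks) ≡ g → e < length g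
  cofactor-degree< {d} {e} cs ks eq = subst (e <_) (degrees-of-factors cs ks eq) (s≤s (ℕ.m≤n+m e d))

  divisor-degree< : ∀ {d} (cs : Vec Carrier d) {g} → MonicDivides E q cs g → d < length g
  divisor-degree< {d} cs (e , ks , _ , eq) = subst (d <_) (degrees-of-factors cs ks eq) (s≤s (ℕ.m≤m+n d e))

module Decidability (E : FiniteField) (q : ℕ) where
  open FiniteField E
  open Polynomials E q

  vectors : ∀ d → List (Vec Carrier d)
  vectors zero = [ [] ]
  vectors (suc d) = cartesianProductWith _∷_ elements (vectors d)

  ∈-vectors : ∀ {d} (cs : Vec Carrier d) → cs ∈ vectors d
  ∈-vectors [] = here refl
  ∈-vectors (c ∷ cs) = ∈-cartesianProductWith⁺ _∷_ (elements-complete c) (∈-vectors cs)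

  module _ {A : Set} (xs : List A) (complete : ∀ x → x ∈ xs) {P : A → Set} (P? : ∀ x → Dec (P x)) where
    all? : Dec (∀ x → P x)
    all? = map′ (λ ps x → All.lookup ps (complete x)) (λ f → All.tabulate (λ {x} _ → f x)) (All.all? P? xs)

    any? : Dec (∃ P)
    any? = map′ Any.satisfied (λ (x , px) → lose (complete x) px) (Any.any? P? xs)

  MonicF? : ∀ {d} (cs : Vec Carrier d) → Dec (MonicF E q cs)
  MonicF? = VecAll.all? (λ a → (a ^ q) ≟ a)

  MonicDivides? : ∀ {d} (cs : Vec Carrier d) g → Dec (MonicDivides E q cs g)
  MonicDivides? cs g =
    map′ (λ (e , _ , cofactor) → e , cofactor) (λ (e , ks , ks∈F , eq) → e , cofactor-degree< cs ks eq , ks , ks∈F , eq)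
      (ℕ.anyUpTo? (λ e → any? (vectors e) ∈-vectors
        (λ ks → MonicF? ks ×-dec List.≡-dec _≟_ (_*p_ E q (monic E q cs) (monic E q ks)) g)) (length g))

  GFree? : ∀ g w → Dec (GFree E q g w)
  GFree? g w =
    map′ (λ free d cs cs∈F cs∣g → free (divisor-degree< cs cs∣g) cs cs∈F cs∣g) (λ free {d} _ → free d)
      (ℕ.allUpTo? (λ d → all? (vectors d) ∈-vectors (λ cs → MonicF? cs →-dec (MonicDivides? cs g →-dec
        all? elements elements-complete (λ v → (w ≟ Hσ E q cs v) →-dec (d ℕ.≟ 0))))) (length g))

  MFree? : ∀ m .{{_ : ℕ.NonZero m}} w → Dec (MFree E q m w)
  MFree? m w = map′ (λ free d v d∣m → free (s≤s (∣⇒≤ d∣m)) v d∣m) (λ free {d} _ → free d)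
    (ℕ.allUpTo? (λ d → all? elements elements-complete (λ v → (d ∣? m) →-dec ((w ≟ (v ^ d)) →-dec (d ℕ.≟ 1)))) (suc m))

  NPred? : ∀ m .{{_ : ℕ.NonZero m}} g h w → Dec (NPred E q m g h w)
  NPred? m g h w = ¬? (w ≟ 0#) ×-dec MFree? m w ×-dec GFree? g w ×-dec GFree? h (w ⁻¹)

module Counting (E : FiniteField) (q : ℕ) where
  open FiniteField E

  HasCount-filter : ∀ {P : Carrier → Set} (P? : ∀ x → Dec (P x)) → HasCount E q P (length (filter P? elements))
  HasCount-filter P? = filter P? elements , Unique.filter⁺ P? elements-unique
    , (λ x → mk⇔ (λ x∈ → proj₂ (∈-filter⁻ P? {xs = elements} x∈)) (∈-filter⁺ P? (elements-complete x))) , refl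

  HasCount-⇔ : ∀ {P Q : Carrier → Set} {k} → (∀ x → P x ⇔ Q x) → HasCount E q P k → HasCount E q Q k
  HasCount-⇔ P⇔Q (xs , xs! , ∈⇔P , |xs|≡k) = xs , xs! ,
    (λ x → mk⇔ (λ x∈ → Equivalence.to (P⇔Q x) (Equivalence.to (∈⇔P x) x∈))
               (λ Qx → Equivalence.from (∈⇔P x) (Equivalence.from (P⇔Q x) Qx))) , |xs|≡k

  sameN-of-⇔ : ∀ m .{{_ : ℕ.NonZero m}} g h m′ g′ h′ →
               (∀ w → NPred E q m g h w ⇔ NPred E q m′ g′ h′ w) → SameN E q m g h m′ g′ h′
  sameN-of-⇔ m g h m′ g′ h′ P⇔Q = _ , count , HasCount-⇔ P⇔Q count
    where count = HasCount-filter (Decidability.NPred? E q m g h)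

module Freeness (E : FiniteField) (q : ℕ) where
  open FiniteField E
  open FiniteFieldTheory E
  open CommutativeRing commutativeRing using (*-identityʳ; *-identityˡ; *-comm; *-assoc)
  open ≡-Reasoning

  -- Bézout: r x = 1 + b y (or the symmetric identity) turns w into an r-th power.
  root-of-coprime : ∀ {w b r} → w ≢ 0# → w ^ b ≡ 1# → Coprime r b → ∃ λ z → w ≡ z ^ r
  root-of-coprime {w} {b} {r} w≢0 wᵇ≡1 r⊥b with coprime-Bézout r⊥b
  ... | Bézout.+- x y 1+y*b≡x*r = w ^ x , (begin
    w                         ≡⟨ sym (*-identityʳ w) ⟩
    w * 1#                    ≡⟨ cong (w *_) (sym (trans (cong (_^ y) wᵇ≡1) (1^n≡1 y))) ⟩
    w * (w ^ b) ^ y           ≡⟨ cong (w *_) (^-*-assoc w b y) ⟩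
    w ^ (1 ℕ.+ b ℕ.* y)       ≡⟨ cong (λ e → w ^ (1 ℕ.+ e)) (ℕ.*-comm b y) ⟩
    w ^ (1 ℕ.+ y ℕ.* b)       ≡⟨ cong (w ^_) 1+y*b≡x*r ⟩
    w ^ (x ℕ.* r)             ≡⟨ sym (^-*-assoc w x r) ⟩
    (w ^ x) ^ r ∎)
  ... | Bézout.-+ x y 1+x*r≡y*b = (w ^ x) ⁻¹ , *-cancelˡ (^-nonzero r wˣ≢0) (begin
    (w ^ x) ^ r * w                 ≡⟨ *-comm _ w ⟩
    w * (w ^ x) ^ r                 ≡⟨ cong (w *_) (^-*-assoc w x r) ⟩
    w ^ (1 ℕ.+ x ℕ.* r)             ≡⟨ cong (w ^_) 1+x*r≡y*b ⟩
    w ^ (y ℕ.* b)                   ≡⟨ cong (w ^_) (ℕ.*-comm y b) ⟩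
    w ^ (b ℕ.* y)                   ≡⟨ sym (^-*-assoc w b y) ⟩
    (w ^ b) ^ y                     ≡⟨ trans (cong (_^ y) wᵇ≡1) (1^n≡1 y) ⟩
    1#                              ≡⟨ sym (1^n≡1 r) ⟩
    1# ^ r                          ≡⟨ cong (_^ r) (sym (⁻¹-inverse (w ^ x) wˣ≢0)) ⟩
    (w ^ x * (w ^ x) ⁻¹) ^ r        ≡⟨ ^-distribʳ-* (w ^ x) ((w ^ x) ⁻¹) r ⟩
    (w ^ x) ^ r * ((w ^ x) ⁻¹) ^ r ∎)
    where wˣ≢0 = ^-nonzero x w≢0

  MFree⇒¬fixed : ∀ {m w r N} → r ≢ 1 → r ∣ m → Coprime r (N ℕ.∸ 1) → 0 < N →
                 w ≢ 0# → MFree E q m w → w ^ N ≢ w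
  MFree⇒¬fixed {w = w} {N = suc N} r≢1 r∣m r⊥N _ w≢0 free w¹⁺ᴺ≡w =
    r≢1 (free _ (proj₁ root) r∣m (proj₂ root))
    where
    wᴺ≡1 : w ^ N ≡ 1#
    wᴺ≡1 = *-cancelˡ w≢0 (trans w¹⁺ᴺ≡w (sym (*-identityʳ w)))
    root = root-of-coprime w≢0 wᴺ≡1 r⊥N

  fixed-⁻¹ : ∀ {w} N → w ≢ 0# → (w ⁻¹) ^ N ≡ w ⁻¹ → w ^ N ≡ w
  fixed-⁻¹ {w} N w≢0 w⁻ᴺ≡w⁻¹ = *-cancelˡ (⁻¹-nonzero w≢0) (begin
    w ⁻¹ * w ^ N              ≡⟨ cong (_* w ^ N) (sym w⁻ᴺ≡w⁻¹) ⟩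
    (w ⁻¹) ^ N * w ^ N        ≡⟨ sym (^-distribʳ-* (w ⁻¹) w N) ⟩
    (w ⁻¹ * w) ^ N            ≡⟨ cong (_^ N) (⁻¹-inverseˡ w≢0) ⟩
    1# ^ N                    ≡⟨ 1^n≡1 N ⟩
    1#                        ≡⟨ sym (⁻¹-inverseˡ w≢0) ⟩
    w ⁻¹ * w ∎)

module DivisorReduction (E : FiniteField) (q : ℕ) where
  open FiniteField E
  open Freeness E q

  MonicFDivisor : Poly E q → ∀ {d} → Vec Carrier d → Set
  MonicFDivisor g cs = MonicF E q cs × MonicDivides E q cs g

  HσFixedBy : ℕ → ∀ {d} → Vec Carrier d → Set
  HσFixedBy N cs = ∀ v → Hσ E q cs v ^ N ≡ Hσ E q cs v

  GFree-antitone : ∀ {g g′} → (∀ {d} (cs : Vec Carrier (suc d)) → MonicFDivisor g′ cs → MonicDivides E q cs g) →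
                   ∀ {w} → GFree E q g w → GFree E q g′ w
  GFree-antitone lift free zero _ _ _ _ _ = refl
  GFree-antitone lift free (suc d) cs cs∈F cs∣g′ = free (suc d) cs cs∈F (lift cs (cs∈F , cs∣g′))

  GFree-reduce : ∀ {g g′ N} → (∀ {d} (cs : Vec Carrier (suc d)) → MonicFDivisor g cs → MonicDivides E q cs g′ ⊎ HσFixedBy N cs) →
                 ∀ {w} → w ^ N ≢ w → GFree E q g′ w → GFree E q g w
  GFree-reduce split ¬fixed free zero _ _ _ _ _ = refl
  GFree-reduce {N = N} split ¬fixed free (suc d) cs cs∈F cs∣g v w≡Hσ with split cs (cs∈F , cs∣g)
  ... | inj₁ cs∣g′ = free (suc d) cs cs∈F cs∣g′ v w≡Hσ
  ... | inj₂ fixed = ⊥-elim (¬fixed (trans (cong (_^ N) w≡Hσ) (trans (fixed v) (sym w≡Hσ))))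

  -- An m-free w ≠ 0 (and likewise w⁻¹) is not fixed by x ↦ x ^ N, so
  -- divisors of g whose σ-images are N-fixed never obstruct g-freeness.
  sameN-reduction : ∀ m .{{_ : ℕ.NonZero m}} g g′ N {r} → r ≢ 1 → r ∣ m → Coprime r (N ℕ.∸ 1) → 0 < N →
                    (∀ {d} (cs : Vec Carrier (suc d)) → MonicFDivisor g′ cs → MonicDivides E q cs g) →
                    (∀ {d} (cs : Vec Carrier (suc d)) → MonicFDivisor g cs → MonicDivides E q cs g′ ⊎ HσFixedBy N cs) →
                    SameN E q m g g m g′ g′
  sameN-reduction m g g′ N r≢1 r∣m r⊥N N>0 lift split =
    Counting.sameN-of-⇔ E q m g g m g′ g′ λ w → mk⇔
      (λ (w≢0 , free , g-free , g-free⁻¹) → w≢0 , free , GFree-antitone lift g-free , GFree-antitone lift g-free⁻¹)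
      (λ (w≢0 , free , g′-free , g′-free⁻¹) →
         let ¬fixed : w ^ N ≢ w
             ¬fixed = MFree⇒¬fixed r≢1 r∣m r⊥N N>0 w≢0 free
         in w≢0 , free , GFree-reduce {N = N} split ¬fixed g′-free
                       , GFree-reduce {N = N} split (λ fixed → ¬fixed (fixed-⁻¹ N w≢0 fixed)) g′-free⁻¹)

module QArithmetic where
  open import Data.Nat using (_+_; _*_; _^_; _%_; NonZero)
  open import Data.Nat.Properties
  open import Data.Nat.GCD using (gcd; gcd-GCD; module GCD)
  open import Data.Nat.Primality using (prime?; prime⇒irreducible; productOfPrimes≢0)
  open import Data.Nat.Primality.Factorisation using (factorise)
  open import Data.Nat.ListAction.Properties using (∈⇒∣product)
  open import Data.List using (upTo)
  open import Data.List.Membership.Propositional.Properties using (∈-upTo⁺)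
  open import Data.Nat.Tactic.RingSolver using (solve-∀)

  radical≢0 : ∀ M → NonZero (radical M)
  radical≢0 M = productOfPrimes≢0 (All.map proj₁ (All.all-filter (λ p → prime? p ×-dec (p ∣? M)) (upTo (suc M))))

  prime∣⇒∣radical : ∀ {p M} → Prime p → p ∣ M → .{{NonZero M}} → p ∣ radical M
  prime∣⇒∣radical {p} {M} p-prime p∣M =
    ∈⇒∣product (∈-filter⁺ (λ p → prime? p ×-dec (p ∣? M)) (∈-upTo⁺ (s≤s (∣⇒≤ p∣M))) (p-prime , p∣M))

  prime-factor : ∀ n → 2 ≤ n → ∃ λ p → Prime p × p ∣ n
  prime-factor n@(suc (suc _)) _ with factorise n
  ... | record { factors = p ∷ ps ; isFactorisation = n≡Πps ; factorsPrime = p-prime ∷ _ } =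
    p , p-prime , subst (p ∣_) (sym n≡Πps) (∈⇒∣product {ns = p ∷ ps} (here refl))
  ... | record { factors = [] ; isFactorisation = () }
  prime-factor 1 (s≤s ())

  prime∤⇒coprime : ∀ {p n} → Prime p → ¬ p ∣ n → Coprime p n
  prime∤⇒coprime p-prime p∤n (d∣p , d∣n) with prime⇒irreducible p-prime d∣p
  ... | inj₁ d≡1 = d≡1
  ... | inj₂ refl = ⊥-elim (p∤n d∣n)

  prime∤1 : ∀ {p} → Prime p → ¬ p ∣ 1
  prime∤1 {p} p-prime p∣1 = ℕ.nonTrivial⇒≢1 {{prime⇒nonTrivial p-prime}} (∣1⇒≡1 p∣1)

  div'-* : ∀ m n → .{{NonZero m}} → div' (m * n) m ≡ n
  div'-* (suc m) n = trans (cong (_/ suc m) (*-comm (suc m) n)) (m*n/n≡m n (suc m))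

  Qnum≢0 : ∀ q n → NonZero (Qnum q n)
  Qnum≢0 q n = radical≢0 (div' (q ^ n ∸ 1) ((q ∸ 1) * gcd n (q ∸ 1)))

  -- For q = 3 + 4j the prime factors of (q² + 1) / 2 = 5 + 12j + 8j² divide Q;
  -- they are odd and, since 2 ((q² + 1) / 2) = (q² - 1) + 2, coprime to q² - 1.
  Qnum-prime-factor-4 : ∀ q → q % 4 ≡ 3 → ∃ λ r → Prime r × r ∣ Qnum q 4 × Coprime r (q ^ 2 ∸ 1)
  Qnum-prime-factor-4 q q%4≡3 = r , r-prime , r∣Q , prime∤⇒coprime r-prime r∤q²-1
    where
    j = q / 4
    q≡3+j*4 : q ≡ 3 + j * 4
    q≡3+j*4 = trans (m≡m%n+[m/n]*n q 4) (cong (_+ j * 4) q%4≡3)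
    s = 5 + j * 12 + j * j * 8
    factor = prime-factor s (s≤s (s≤s z≤n))
    r = proj₁ factor
    r-prime = proj₁ (proj₂ factor)
    r∣s = proj₂ (proj₂ factor)

    q-1≡[1+2j]*2 : ∀ j → 2 + j * 4 ≡ (1 + j * 2) * 2
    q-1≡[1+2j]*2 = solve-∀
    q⁴≡1+[q-1]*2*[q+1]*s : ∀ j → let t = 3 + j * 4 in t * (t * (t * (t * 1))) ≡ 1 + (2 + j * 4) * 2 * ((4 + j * 4) * (5 + j * 12 + j * j * 8))
    q⁴≡1+[q-1]*2*[q+1]*s = solve-∀
    q²≡1+[2s-2] : ∀ j → (3 + j * 4) * ((3 + j * 4) * 1) ≡ 1 + (8 + j * 24 + j * j * 16)
    q²≡1+[2s-2] = solve-∀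
    2s≡[q²-1]+2 : ∀ j → (5 + j * 12 + j * j * 8) * 2 ≡ (8 + j * 24 + j * j * 16) + 2
    2s≡[q²-1]+2 = solve-∀
    s≡2t+1 : ∀ j → 5 + j * 12 + j * j * 8 ≡ 2 * (2 + j * 6 + j * j * 4) + 1
    s≡2t+1 = solve-∀

    gcd[4,q-1]≡2 : gcd 4 (q ∸ 1) ≡ 2
    gcd[4,q-1]≡2 rewrite q≡3+j*4 = GCD.unique (gcd-GCD 4 (2 + j * 4))
      (GCD.is (divides 2 refl , divides (1 + j * 2) (q-1≡[1+2j]*2 j))
              (λ {d} (d∣4 , d∣2+4j) → ∣m+n∣m⇒∣n (subst (d ∣_) (+-comm 2 (j * 4)) d∣2+4j) (∣n⇒∣m*n j d∣4)))

    Qarg≡[q+1]*s : div' (q ^ 4 ∸ 1) ((q ∸ 1) * gcd 4 (q ∸ 1)) ≡ (4 + j * 4) * s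
    Qarg≡[q+1]*s = begin
      div' (q ^ 4 ∸ 1) ((q ∸ 1) * gcd 4 (q ∸ 1))     ≡⟨ cong₂ (λ a b → div' (a ∸ 1) ((q ∸ 1) * b)) (cong (_^ 4) q≡3+j*4) gcd[4,q-1]≡2 ⟩
      div' ((3 + j * 4) ^ 4 ∸ 1) ((q ∸ 1) * 2)       ≡⟨ cong₂ (λ a b → div' (a ∸ 1) (b * 2)) (q⁴≡1+[q-1]*2*[q+1]*s j) (cong (_∸ 1) q≡3+j*4) ⟩
      div' ((2 + j * 4) * 2 * ((4 + j * 4) * s)) ((2 + j * 4) * 2)  ≡⟨ div'-* ((2 + j * 4) * 2) ((4 + j * 4) * s) ⟩
      (4 + j * 4) * s ∎
      where open ≡-Reasoning

    r∣Q : r ∣ Qnum q 4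
    r∣Q = prime∣⇒∣radical r-prime (subst (r ∣_) (sym Qarg≡[q+1]*s) (∣n⇒∣m*n (4 + j * 4) r∣s))
            {{subst NonZero (sym Qarg≡[q+1]*s) _}}

    r∤q²-1 : ¬ r ∣ q ^ 2 ∸ 1
    r∤q²-1 r∣q²-1 = prime∤1 r-prime (∣m+n∣m⇒∣n (subst (r ∣_) (s≡2t+1 j) r∣s) (∣m⇒∣m*n (2 + j * 6 + j * j * 4) r∣2))
      where
      r∣2 : r ∣ 2
      r∣2 = ∣m+n∣m⇒∣n (subst (r ∣_) (2s≡[q²-1]+2 j) (∣m⇒∣m*n 2 r∣s))
                       (subst (r ∣_) (cong (_∸ 1) (trans (cong (_^ 2) q≡3+j*4) (q²≡1+[2s-2] j))) r∣q²-1)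

  -- For q = 2 + 3j the prime factors of q² + q + 1 = 7 + 15j + 9j² divide Q;
  -- since q² + q + 1 = (q - 1)(q + 2) + 3 ≡ 1 (mod 3), they are coprime to q - 1.
  Qnum-prime-factor-3 : ∀ q → q % 3 ≡ 2 → ∃ λ r → Prime r × r ∣ Qnum q 3 × Coprime r (q ^ 1 ∸ 1)
  Qnum-prime-factor-3 q q%3≡2 = r , r-prime , r∣Q , prime∤⇒coprime r-prime r∤q-1
    where
    j = q / 3
    q≡2+j*3 : q ≡ 2 + j * 3
    q≡2+j*3 = trans (m≡m%n+[m/n]*n q 3) (cong (_+ j * 3) q%3≡2)
    s = 7 + j * 15 + j * j * 9
    factor = prime-factor s (s≤s (s≤s z≤n))
    r = proj₁ factor
    r-prime = proj₁ (proj₂ factor)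
    r∣s = proj₂ (proj₂ factor)

    q-1≡[1+3j]*1 : ∀ j → 1 + j * 3 ≡ (1 + j * 3) * 1
    q-1≡[1+3j]*1 = solve-∀
    q³≡1+[q-1]*1*s : ∀ j → let t = 2 + j * 3 in t * (t * (t * 1)) ≡ 1 + (1 + j * 3) * 1 * (7 + j * 15 + j * j * 9)
    q³≡1+[q-1]*1*s = solve-∀
    q≡1+[q-1] : ∀ j → (2 + j * 3) * 1 ≡ 1 + (1 + j * 3)
    q≡1+[q-1] = solve-∀
    s≡[q-1]*[q+2]+3 : ∀ j → 7 + j * 15 + j * j * 9 ≡ (1 + j * 3) * (4 + j * 3) + 3
    s≡[q-1]*[q+2]+3 = solve-∀
    s≡3t+1 : ∀ j → 7 + j * 15 + j * j * 9 ≡ 3 * (2 + j * 5 + j * j * 3) + 1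
    s≡3t+1 = solve-∀

    gcd[3,q-1]≡1 : gcd 3 (q ∸ 1) ≡ 1
    gcd[3,q-1]≡1 rewrite q≡2+j*3 = GCD.unique (gcd-GCD 3 (1 + j * 3))
      (GCD.is (divides 3 refl , divides (1 + j * 3) (q-1≡[1+3j]*1 j))
              (λ {d} (d∣3 , d∣1+3j) → ∣m+n∣m⇒∣n (subst (d ∣_) (+-comm 1 (j * 3)) d∣1+3j) (∣n⇒∣m*n j d∣3)))

    Qarg≡s : div' (q ^ 3 ∸ 1) ((q ∸ 1) * gcd 3 (q ∸ 1)) ≡ s
    Qarg≡s = begin
      div' (q ^ 3 ∸ 1) ((q ∸ 1) * gcd 3 (q ∸ 1))     ≡⟨ cong₂ (λ a b → div' (a ∸ 1) ((q ∸ 1) * b)) (cong (_^ 3) q≡2+j*3) gcd[3,q-1]≡1 ⟩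
      div' ((2 + j * 3) ^ 3 ∸ 1) ((q ∸ 1) * 1)       ≡⟨ cong₂ (λ a b → div' (a ∸ 1) (b * 1)) (q³≡1+[q-1]*1*s j) (cong (_∸ 1) q≡2+j*3) ⟩
      div' ((1 + j * 3) * 1 * s) ((1 + j * 3) * 1)   ≡⟨ div'-* ((1 + j * 3) * 1) s ⟩
      s ∎
      where open ≡-Reasoning

    r∣Q : r ∣ Qnum q 3
    r∣Q = prime∣⇒∣radical r-prime (subst (r ∣_) (sym Qarg≡s) r∣s) {{subst NonZero (sym Qarg≡s) _}}

    r∤q-1 : ¬ r ∣ q ^ 1 ∸ 1
    r∤q-1 r∣q-1 = prime∤1 r-prime (∣m+n∣m⇒∣n (subst (r ∣_) (s≡3t+1 j) r∣s) (∣m⇒∣m*n (2 + j * 5 + j * j * 3) r∣3))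
      where
      r∣3 : r ∣ 3
      r∣3 = ∣m+n∣m⇒∣n (subst (r ∣_) (s≡[q-1]*[q+2]+3 j) r∣s)
                       (∣m⇒∣m*n (4 + j * 3) (subst (r ∣_) (cong (_∸ 1) (trans (cong (λ t → t * 1) q≡2+j*3) (q≡1+[q-1] j))) r∣q-1))

  odd-^ : ∀ {m} n → m % 2 ≡ 1 → m ^ n % 2 ≡ 1
  odd-^ zero _ = refl
  odd-^ {m} (suc n) m%2≡1 = begin
    (m * m ^ n) % 2                ≡⟨ %-distribˡ-* m (m ^ n) 2 ⟩
    ((m % 2) * (m ^ n % 2)) % 2    ≡⟨ cong₂ (λ a b → (a * b) % 2) m%2≡1 (odd-^ n m%2≡1) ⟩
    1 ∎
    where open ≡-Reasoning


open QArithmetic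

module QuarticCase (E : FiniteField) (q : ℕ) {p k : ℕ} (p-prime : Prime p) (q≡pᵏ : q ≡ p ℕ.^ k)
                   (order≡q⁴ : FiniteField.order E ≡ q ℕ.^ 4) (q%4≡3 : q ℕ.% 4 ≡ 3) where
  open FiniteField E
  open FiniteFieldTheory E
  open Extension E q {p} {k} p-prime q≡pᵏ 4 order≡q⁴
  open Polynomials E q
  open DivisorReduction E q
  open CommutativeRing commutativeRing using (*-identityˡ; *-identityʳ; +-identityʳ; -‿inverseˡ; _-_; ring)
  open Algebra.Properties.Ring ring using (x∙y⁻¹≈ε⇒x≈y)
  open ≡-Reasoning

  1+1≢0 : 1# + 1# ≢ 0#
  1+1≢0 = odd-order⇒1+1≢0 (trans (cong (ℕ._% 2) order≡q⁴) (odd-^ {q} 4 q%2≡1))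
    where
    q%2≡1 : q ℕ.% 2 ≡ 1
    q%2≡1 = trans (sym (m∣n⇒o%n%m≡o%m 2 4 q (divides 2 refl))) (cong (ℕ._% 2) q%4≡3)

  F-fourth-root : ∀ {a} → InF E q a → a ^ 4 ≡ 1# → a * a ≡ 1#
  F-fourth-root {a} a∈F a⁴≡1 = *-cancelˡ a≢0 (begin
    a * (a * a)         ≡⟨ cong (a *_) (cong (a *_) (sym (*-identityʳ a))) ⟩
    a ^ 3               ≡⟨ cong (a ^_) (sym q%4≡3) ⟩
    a ^ (q ℕ.% 4)       ≡⟨ sym (^-% 4 q a⁴≡1) ⟩
    a ^ q               ≡⟨ a∈F ⟩
    a                   ≡⟨ sym (*-identityʳ a) ⟩
    a * 1# ∎)
    where
    a≢0 : a ≢ 0#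
    a≢0 refl = 0≢1 (trans (sym (zeroˡ _)) a⁴≡1)
      where open CommutativeRing commutativeRing using (zeroˡ)

  F-no-square-root-of-−1 : ∀ {a} → InF E q a → a * a ≢ - 1#
  F-no-square-root-of-−1 {a} a∈F a²≡-1 = 1+1≢0 (begin
    1# + 1#             ≡⟨ cong (_+ 1#) (sym a²≡1) ⟩
    a * a + 1#          ≡⟨ cong (_+ 1#) a²≡-1 ⟩
    - 1# + 1#           ≡⟨ -‿inverseˡ 1# ⟩
    0# ∎)
    where
    a²≡1 : a * a ≡ 1#
    a²≡1 = F-fourth-root a∈F (begin
      a ^ 4                  ≡⟨ solve 1 (λ a → a :* (a :* (a :* (a :* :1))) := (a :* a) :* (a :* a)) refl a ⟩
      (a * a) * (a * a)      ≡⟨ cong₂ _*_ a²≡-1 a²≡-1 ⟩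
      - 1# * - 1#            ≡⟨ solve 0 (:- :1 :* :- :1 := :1) refl ⟩
      1# ∎)

  Hσ[x²+1]-fixed : HσFixedBy (q ℕ.^ 2) (1# ∷ 0# ∷ [])
  Hσ[x²+1]-fixed v = begin
    Hσ E q (1# ∷ 0# ∷ []) v ^ (q ℕ.^ 2)          ≡⟨ Hσ-frobenius 2 (1# ∷ 0# ∷ []) (1∈F ∷ 0∈F ∷ []) v ⟩
    1# * V 2 + (0# * V 3 + (1# * V 4 + 0#))      ≡⟨ cong (λ x → 1# * V 2 + (0# * V 3 + (1# * x + 0#))) (fermat-qⁿ v) ⟩
    1# * V 2 + (0# * V 3 + (1# * v + 0#))        ≡⟨ solve 4 (λ v V₁ V₂ V₃ → :1 :* V₂ :+ (:0 :* V₃ :+ (:1 :* v :+ :0))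
                                                             := :1 :* (v :* :1) :+ (:0 :* V₁ :+ (:1 :* V₂ :+ :0))) refl v (V 1) (V 2) (V 3) ⟩
    Hσ E q (1# ∷ 0# ∷ []) v ∎
    where V = λ i → v ^ (q ℕ.^ i)

  Hσ[x³+ax²+x+a]-fixed : ∀ {a} → InF E q a → HσFixedBy (q ℕ.^ 2) (a ∷ 1# ∷ a ∷ [])
  Hσ[x³+ax²+x+a]-fixed {a} a∈F v = begin
    Hσ E q (a ∷ 1# ∷ a ∷ []) v ^ (q ℕ.^ 2)                    ≡⟨ Hσ-frobenius 2 (a ∷ 1# ∷ a ∷ []) (a∈F ∷ 1∈F ∷ a∈F ∷ []) v ⟩
    a * V 2 + (1# * V 3 + (a * V 4 + (1# * V 5 + 0#)))         ≡⟨ cong₂ (λ x y → a * V 2 + (1# * V 3 + (a * x + (1# * y + 0#)))) (fermat-qⁿ v) (fermat-qⁿ⁺ⁱ v 1) ⟩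
    a * V 2 + (1# * V 3 + (a * v + (1# * V 1 + 0#)))           ≡⟨ solve 5 (λ a v V₁ V₂ V₃ → a :* V₂ :+ (:1 :* V₃ :+ (a :* v :+ (:1 :* V₁ :+ :0)))
                                                                    := a :* (v :* :1) :+ (:1 :* V₁ :+ (a :* V₂ :+ (:1 :* V₃ :+ :0)))) refl a v (V 1) (V 2) (V 3) ⟩
    Hσ E q (a ∷ 1# ∷ a ∷ []) v ∎
    where V = λ i → v ^ (q ℕ.^ i)

  Hσ[x⁴-1]-fixed : HσFixedBy (q ℕ.^ 2) (- 1# ∷ 0# ∷ 0# ∷ 0# ∷ [])
  Hσ[x⁴-1]-fixed v = trans (cong (_^ (q ℕ.^ 2)) Hσ≡0) (trans (0^n≡0 (q ℕ.^ 2) {{qⁱ≢0 2}}) (sym Hσ≡0))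
    where
    V = λ i → v ^ (q ℕ.^ i)
    Hσ≡0 : Hσ E q (- 1# ∷ 0# ∷ 0# ∷ 0# ∷ []) v ≡ 0#
    Hσ≡0 = begin
      - 1# * (v * 1#) + (0# * V 1 + (0# * V 2 + (0# * V 3 + (1# * V 4 + 0#))))   ≡⟨ cong (λ x → - 1# * (v * 1#) + (0# * V 1 + (0# * V 2 + (0# * V 3 + (1# * x + 0#))))) (fermat-qⁿ v) ⟩
      - 1# * (v * 1#) + (0# * V 1 + (0# * V 2 + (0# * V 3 + (1# * v + 0#))))     ≡⟨ solve 4 (λ v V₁ V₂ V₃ → :- :1 :* (v :* :1) :+ (:0 :* V₁ :+ (:0 :* V₂ :+ (:0 :* V₃ :+ (:1 :* v :+ :0)))) := :0) refl v (V 1) (V 2) (V 3) ⟩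
      0# ∎

  linear-divisor-of-x⁴-1 : ∀ {a k₀ k₁ k₂} → InF E q a →
                           _*p_ E q (monic E q (a ∷ [])) (monic E q (k₀ ∷ k₁ ∷ k₂ ∷ [])) ≡ xⁿ-1 E q 4 →
                           MonicDivides E q (a ∷ []) (xⁿ-1 E q 2)
  linear-divisor-of-x⁴-1 {a} {k₀} {k₁} {k₂} a∈F eq = 1 , - a ∷ [] , -‿∈F a∈F ∷ [] , Pointwise-≡⇒≡ (d₀ ∷ d₁ ∷ *-identityˡ 1# ∷ [])
    where
    c₀ : a * k₀ + 0# ≡ - 1#
    c₀ = cong (coefficient 0) eq
    c₁ : a * k₁ + (1# * k₀ + 0#) ≡ 0#
    c₁ = cong (coefficient 1) eq
    c₂ : a * k₂ + 1# * k₁ ≡ 0#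
    c₂ = cong (coefficient 2) eq
    c₃ : a * 1# + 1# * k₂ ≡ 0#
    c₃ = cong (coefficient 3) eq
    a⁴≡1 : a ^ 4 ≡ 1#
    a⁴≡1 = begin
      a ^ 4
        ≡⟨ solve 4 (λ a k₀ k₁ k₂ → a :* (a :* (a :* (a :* :1))) :=
             a :* a :* a :* (a :* :1 :+ :1 :* k₂) :- a :* a :* (a :* k₂ :+ :1 :* k₁)
             :+ a :* (a :* k₁ :+ (:1 :* k₀ :+ :0)) :- (a :* k₀ :+ :0)) refl a k₀ k₁ k₂ ⟩
      a * a * a * (a * 1# + 1# * k₂) - a * a * (a * k₂ + 1# * k₁) + a * (a * k₁ + (1# * k₀ + 0#)) - (a * k₀ + 0#)
        ≡⟨ cong₂ _-_ (cong₂ _+_ (cong₂ _-_ (cong (a * a * a *_) c₃) (cong (a * a *_) c₂)) (cong (a *_) c₁)) c₀ ⟩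
      a * a * a * 0# - a * a * 0# + a * 0# - - 1#
        ≡⟨ solve 1 (λ a → a :* a :* a :* :0 :- a :* a :* :0 :+ a :* :0 :- :- :1 := :1) refl a ⟩
      1# ∎
    d₀ : a * - a + 0# ≡ - 1#
    d₀ = trans (solve 1 (λ a → a :* :- a :+ :0 := :- (a :* a)) refl a) (cong -_ (F-fourth-root a∈F a⁴≡1))
    d₁ : a * 1# + (1# * - a + 0#) ≡ 0#
    d₁ = solve 1 (λ a → a :* :1 :+ (:1 :* :- a :+ :0) := :0) refl a

  x²-1∣x²-1 : MonicDivides E q (- 1# ∷ 0# ∷ []) (xⁿ-1 E q 2)
  x²-1∣x²-1 = 0 , [] , [] , Pointwise-≡⇒≡
    ( solve 0 (:- :1 :* :1 :+ :0 := :- :1) refl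
    ∷ solve 0 (:0 :* :1 :+ :0 := :0) refl
    ∷ solve 0 (:1 :* :1 :+ :0 := :1) refl ∷ [])

  quadratic-divisor-of-x⁴-1 : ∀ {a₀ a₁ b₀ b₁} → InF E q a₀ →
                              _*p_ E q (monic E q (a₀ ∷ a₁ ∷ [])) (monic E q (b₀ ∷ b₁ ∷ [])) ≡ xⁿ-1 E q 4 →
                              MonicDivides E q (a₀ ∷ a₁ ∷ []) (xⁿ-1 E q 2) ⊎ HσFixedBy (q ℕ.^ 2) (a₀ ∷ a₁ ∷ [])
  quadratic-divisor-of-x⁴-1 {a₀} {a₁} {b₀} {b₁} a₀∈F eq =
    [ a₁≡0⇒ , (λ b₀-a₀≡0 → ⊥-elim (F-no-square-root-of-−1 a₀∈F (a₀²≡-1 b₀-a₀≡0))) ]′ (x*y≡0⇒x≡0∨y≡0 a₁ a₁[b₀-a₀]≡0)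
    where
    c₀ : a₀ * b₀ + 0# ≡ - 1#
    c₀ = cong (coefficient 0) eq
    c₁ : a₀ * b₁ + (a₁ * b₀ + 0#) ≡ 0#
    c₁ = cong (coefficient 1) eq
    c₂ : a₀ * 1# + (a₁ * b₁ + (1# * b₀ + 0#)) ≡ 0#
    c₂ = cong (coefficient 2) eq
    c₃ : a₁ * 1# + 1# * b₁ ≡ 0#
    c₃ = cong (coefficient 3) eq

    a₁[b₀-a₀]≡0 : a₁ * (b₀ - a₀) ≡ 0#
    a₁[b₀-a₀]≡0 = begin
      a₁ * (b₀ - a₀)
        ≡⟨ solve 4 (λ a₀ a₁ b₀ b₁ → a₁ :* (b₀ :- a₀) := (a₀ :* b₁ :+ (a₁ :* b₀ :+ :0)) :- a₀ :* (a₁ :* :1 :+ :1 :* b₁)) refl a₀ a₁ b₀ b₁ ⟩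
      (a₀ * b₁ + (a₁ * b₀ + 0#)) - a₀ * (a₁ * 1# + 1# * b₁)
        ≡⟨ cong₂ (λ s t → s - a₀ * t) c₁ c₃ ⟩
      0# - a₀ * 0#
        ≡⟨ solve 1 (λ a₀ → :0 :- a₀ :* :0 := :0) refl a₀ ⟩
      0# ∎

    a₀²≡-1 : b₀ - a₀ ≡ 0# → a₀ * a₀ ≡ - 1#
    a₀²≡-1 b₀-a₀≡0 = begin
      a₀ * a₀        ≡⟨ cong (a₀ *_) (sym (x∙y⁻¹≈ε⇒x≈y b₀ a₀ b₀-a₀≡0)) ⟩
      a₀ * b₀        ≡⟨ sym (+-identityʳ _) ⟩
      a₀ * b₀ + 0#   ≡⟨ c₀ ⟩
      - 1# ∎

    a₀²≡1 : a₁ ≡ 0# → a₀ * a₀ ≡ 1#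
    a₀²≡1 a₁≡0 = begin
      a₀ * a₀
        ≡⟨ solve 4 (λ a₀ a₁ b₀ b₁ → a₀ :* a₀ := a₀ :* (a₀ :* :1 :+ (a₁ :* b₁ :+ (:1 :* b₀ :+ :0))) :- (a₀ :* b₀ :+ :0) :- a₀ :* a₁ :* b₁) refl a₀ a₁ b₀ b₁ ⟩
      a₀ * (a₀ * 1# + (a₁ * b₁ + (1# * b₀ + 0#))) - (a₀ * b₀ + 0#) - a₀ * a₁ * b₁
        ≡⟨ cong₂ _-_ (cong₂ (λ s t → a₀ * s - t) c₂ c₀) (cong (λ t → a₀ * t * b₁) a₁≡0) ⟩
      a₀ * 0# - - 1# - a₀ * 0# * b₁
        ≡⟨ solve 2 (λ a₀ b₁ → a₀ :* :0 :- :- :1 :- a₀ :* :0 :* b₁ := :1) refl a₀ b₁ ⟩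
      1# ∎

    a₁≡0⇒ : a₁ ≡ 0# → MonicDivides E q (a₀ ∷ a₁ ∷ []) (xⁿ-1 E q 2) ⊎ HσFixedBy (q ℕ.^ 2) (a₀ ∷ a₁ ∷ [])
    a₁≡0⇒ a₁≡0 =
      [ (λ a₀≡1 → inj₂ (subst₂ (λ x y → HσFixedBy (q ℕ.^ 2) (x ∷ y ∷ [])) (sym a₀≡1) (sym a₁≡0) Hσ[x²+1]-fixed))
      , (λ a₀≡-1 → inj₁ (subst₂ (λ x y → MonicDivides E q (x ∷ y ∷ []) (xⁿ-1 E q 2)) (sym a₀≡-1) (sym a₁≡0) x²-1∣x²-1))
      ]′ (x*x≡1⇒x≡±1 a₀ (a₀²≡1 a₁≡0))

  cubic-divisor-of-x⁴-1 : ∀ {a₀ a₁ a₂ b} → InF E q a₂ → InF E q b →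
                          _*p_ E q (monic E q (a₀ ∷ a₁ ∷ a₂ ∷ [])) (monic E q (b ∷ [])) ≡ xⁿ-1 E q 4 →
                          HσFixedBy (q ℕ.^ 2) (a₀ ∷ a₁ ∷ a₂ ∷ [])
  cubic-divisor-of-x⁴-1 {a₀} {a₁} {a₂} {b} a₂∈F b∈F eq =
    subst₂ (λ x y → HσFixedBy (q ℕ.^ 2) (x ∷ y ∷ a₂ ∷ [])) (sym a₀≡a₂) (sym a₁≡1) (Hσ[x³+ax²+x+a]-fixed a₂∈F)
    where
    c₀ : a₀ * b + 0# ≡ - 1#
    c₀ = cong (coefficient 0) eq
    c₁ : a₀ * 1# + (a₁ * b + 0#) ≡ 0#
    c₁ = cong (coefficient 1) eq
    c₂ : a₁ * 1# + (a₂ * b + 0#) ≡ 0#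
    c₂ = cong (coefficient 2) eq
    c₃ : a₂ * 1# + (1# * b + 0#) ≡ 0#
    c₃ = cong (coefficient 3) eq

    b²≡1 : b * b ≡ 1#
    b²≡1 = F-fourth-root b∈F (begin
      b ^ 4
        ≡⟨ solve 4 (λ a₀ a₁ a₂ b → b :* (b :* (b :* (b :* :1))) :=
             b :* b :* b :* (a₂ :* :1 :+ (:1 :* b :+ :0)) :- b :* b :* (a₁ :* :1 :+ (a₂ :* b :+ :0))
             :+ b :* (a₀ :* :1 :+ (a₁ :* b :+ :0)) :- (a₀ :* b :+ :0)) refl a₀ a₁ a₂ b ⟩
      b * b * b * (a₂ * 1# + (1# * b + 0#)) - b * b * (a₁ * 1# + (a₂ * b + 0#))
        + b * (a₀ * 1# + (a₁ * b + 0#)) - (a₀ * b + 0#)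
        ≡⟨ cong₂ _-_ (cong₂ _+_ (cong₂ _-_ (cong (b * b * b *_) c₃) (cong (b * b *_) c₂)) (cong (b *_) c₁)) c₀ ⟩
      b * b * b * 0# - b * b * 0# + b * 0# - - 1#
        ≡⟨ solve 1 (λ b → b :* b :* b :* :0 :- b :* b :* :0 :+ b :* :0 :- :- :1 := :1) refl b ⟩
      1# ∎)

    a₁≡1 : a₁ ≡ 1#
    a₁≡1 = begin
      a₁
        ≡⟨ solve 3 (λ a₁ a₂ b → a₁ := (a₁ :* :1 :+ (a₂ :* b :+ :0)) :- b :* (a₂ :* :1 :+ (:1 :* b :+ :0)) :+ b :* b) refl a₁ a₂ b ⟩
      (a₁ * 1# + (a₂ * b + 0#)) - b * (a₂ * 1# + (1# * b + 0#)) + b * b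
        ≡⟨ cong₂ _+_ (cong₂ (λ s t → s - b * t) c₂ c₃) b²≡1 ⟩
      0# - b * 0# + 1#
        ≡⟨ solve 1 (λ b → :0 :- b :* :0 :+ :1 := :1) refl b ⟩
      1# ∎

    a₀≡a₂ : a₀ ≡ a₂
    a₀≡a₂ = begin
      a₀
        ≡⟨ solve 4 (λ a₀ a₁ a₂ b → a₀ := (a₀ :* :1 :+ (a₁ :* b :+ :0)) :- b :* (a₁ :* :1 :+ (a₂ :* b :+ :0)) :+ a₂ :* (b :* b)) refl a₀ a₁ a₂ b ⟩
      (a₀ * 1# + (a₁ * b + 0#)) - b * (a₁ * 1# + (a₂ * b + 0#)) + a₂ * (b * b)
        ≡⟨ cong₂ _+_ (cong₂ (λ s t → s - b * t) c₁ c₂) (cong (a₂ *_) b²≡1) ⟩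
      0# - b * 0# + a₂ * 1#
        ≡⟨ solve 2 (λ a₂ b → :0 :- b :* :0 :+ a₂ :* :1 := a₂) refl a₂ b ⟩
      a₂ ∎

  quartic-divisor-of-x⁴-1 : ∀ {a₀ a₁ a₂ a₃} →
                            _*p_ E q (monic E q (a₀ ∷ a₁ ∷ a₂ ∷ a₃ ∷ [])) (monic E q []) ≡ xⁿ-1 E q 4 →
                            HσFixedBy (q ℕ.^ 2) (a₀ ∷ a₁ ∷ a₂ ∷ a₃ ∷ [])
  quartic-divisor-of-x⁴-1 {a₀} {a₁} {a₂} {a₃} eq = subst (HσFixedBy (q ℕ.^ 2))
    (sym (cong₂ Vec._∷_ (trans (unit a₀) (cong (coefficient 0) eq)) (cong₂ Vec._∷_ (trans (unit a₁) (cong (coefficient 1) eq))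
         (cong₂ Vec._∷_ (trans (unit a₂) (cong (coefficient 2) eq)) (cong (Vec._∷ []) (trans (unit a₃) (cong (coefficient 3) eq)))))))
    Hσ[x⁴-1]-fixed
    where
    unit : ∀ a → a ≡ a * 1# + 0#
    unit a = solve 1 (λ a → a := a :* :1 :+ :0) refl a

  divisor-of-x⁴-1-splits : ∀ {d} (cs : Vec Carrier (suc d)) → MonicFDivisor (xⁿ-1 E q 4) cs →
                           MonicDivides E q cs (xⁿ-1 E q 2) ⊎ HσFixedBy (q ℕ.^ 2) cs
  divisor-of-x⁴-1-splits cs (cs∈F , _ , ks , ks∈F , eq) =
    by-degree cs ks cs∈F ks∈F (ℕ.suc-injective (ℕ.suc-injective (degrees-of-factors cs ks eq))) eq
    where
    by-degree : ∀ {d e} (cs : Vec Carrier (suc d)) (ks : Vec Carrier e) → MonicF E q cs → MonicF E q ks →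
                d ℕ.+ e ≡ 3 → _*p_ E q (monic E q cs) (monic E q ks) ≡ xⁿ-1 E q 4 →
                MonicDivides E q cs (xⁿ-1 E q 2) ⊎ HσFixedBy (q ℕ.^ 2) cs
    by-degree {0} (_ ∷ []) (_ ∷ _ ∷ _ ∷ []) (a∈F ∷ []) _ refl eq = inj₁ (linear-divisor-of-x⁴-1 a∈F eq)
    by-degree {1} (_ ∷ _ ∷ []) (_ ∷ _ ∷ []) (a₀∈F ∷ _) _ refl eq = quadratic-divisor-of-x⁴-1 a₀∈F eq
    by-degree {2} (_ ∷ _ ∷ _ ∷ []) (_ ∷ []) (_ ∷ _ ∷ a₂∈F ∷ []) (b∈F ∷ []) refl eq = inj₂ (cubic-divisor-of-x⁴-1 a₂∈F b∈F eq)
    by-degree {3} (_ ∷ _ ∷ _ ∷ _ ∷ []) [] _ _ refl eq = inj₂ (quartic-divisor-of-x⁴-1 eq)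
    by-degree {suc (suc (suc (suc _)))} _ _ _ _ () _

  -- The cofactor of x² - 1, times x² + 1, is a cofactor of x⁴ - 1.
  divisor-of-x²-1-lifts : ∀ {d} (cs : Vec Carrier (suc d)) → MonicFDivisor (xⁿ-1 E q 2) cs → MonicDivides E q cs (xⁿ-1 E q 4)
  divisor-of-x²-1-lifts cs (_ , _ , ks , ks∈F , eq) = by-degree cs ks ks∈F (ℕ.suc-injective (ℕ.suc-injective (degrees-of-factors cs ks eq))) eq
    where
    by-degree : ∀ {d e} (cs : Vec Carrier (suc d)) (ks : Vec Carrier e) → MonicF E q ks →
                d ℕ.+ e ≡ 1 → _*p_ E q (monic E q cs) (monic E q ks) ≡ xⁿ-1 E q 2 → MonicDivides E q cs (xⁿ-1 E q 4)
    by-degree {0} (a ∷ []) (b ∷ []) (b∈F ∷ []) refl eq = 3 , b ∷ 1# ∷ b ∷ [] , b∈F ∷ 1∈F ∷ b∈F ∷ [] ,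
      Pointwise-≡⇒≡ (c₀ ∷ c₁ ∷ d₂ ∷ d₃ ∷ *-identityˡ 1# ∷ [])
      where
      c₀ : a * b + 0# ≡ - 1#
      c₀ = cong (coefficient 0) eq
      c₁ : a * 1# + (1# * b + 0#) ≡ 0#
      c₁ = cong (coefficient 1) eq
      d₂ : a * b + 1# * 1# ≡ 0#
      d₂ = begin
        a * b + 1# * 1#      ≡⟨ solve 2 (λ a b → a :* b :+ :1 :* :1 := (a :* b :+ :0) :+ :1) refl a b ⟩
        (a * b + 0#) + 1#    ≡⟨ cong (_+ 1#) c₀ ⟩
        - 1# + 1#            ≡⟨ -‿inverseˡ 1# ⟩
        0# ∎
      d₃ : a * 1# + 1# * b ≡ 0#
      d₃ = trans (solve 2 (λ a b → a :* :1 :+ :1 :* b := a :* :1 :+ (:1 :* b :+ :0)) refl a b) c₁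
    by-degree {1} (a₀ ∷ a₁ ∷ []) [] [] refl eq = 2 , 1# ∷ 0# ∷ [] , 1∈F ∷ 0∈F ∷ [] ,
      Pointwise-≡⇒≡ (c₀ ∷ d₁ ∷ d₂ ∷ d₃ ∷ *-identityˡ 1# ∷ [])
      where
      c₀ : a₀ * 1# + 0# ≡ - 1#
      c₀ = cong (coefficient 0) eq
      c₁ : a₁ * 1# + 0# ≡ 0#
      c₁ = cong (coefficient 1) eq
      d₁ : a₀ * 0# + (a₁ * 1# + 0#) ≡ 0#
      d₁ = trans (solve 2 (λ a₀ a₁ → a₀ :* :0 :+ (a₁ :* :1 :+ :0) := a₁ :* :1 :+ :0) refl a₀ a₁) c₁
      d₂ : a₀ * 1# + (a₁ * 0# + (1# * 1# + 0#)) ≡ 0#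
      d₂ = begin
        a₀ * 1# + (a₁ * 0# + (1# * 1# + 0#))   ≡⟨ solve 2 (λ a₀ a₁ → a₀ :* :1 :+ (a₁ :* :0 :+ (:1 :* :1 :+ :0)) := (a₀ :* :1 :+ :0) :+ :1) refl a₀ a₁ ⟩
        (a₀ * 1# + 0#) + 1#                    ≡⟨ cong (_+ 1#) c₀ ⟩
        - 1# + 1#                              ≡⟨ -‿inverseˡ 1# ⟩
        0# ∎
      d₃ : a₁ * 1# + 1# * 0# ≡ 0#
      d₃ = trans (solve 1 (λ a₁ → a₁ :* :1 :+ :1 :* :0 := a₁ :* :1 :+ :0) refl a₁) c₁
    by-degree {suc (suc _)} _ _ _ () _

  N[Q,x⁴-1,x⁴-1]≡N[Q,x²-1,x²-1] :
    SameN E q (Qnum q 4) (xⁿ-1 E q 4) (xⁿ-1 E q 4) (Qnum q 4) (xⁿ-1 E q 2) (xⁿ-1 E q 2)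
  N[Q,x⁴-1,x⁴-1]≡N[Q,x²-1,x²-1] =
    let (r , r-prime , r∣Q , r⊥q²-1) = Qnum-prime-factor-4 q q%4≡3 in
    sameN-reduction (Qnum q 4) {{Qnum≢0 q 4}} (xⁿ-1 E q 4) (xⁿ-1 E q 2) (q ℕ.^ 2)
      (ℕ.nonTrivial⇒≢1 {{prime⇒nonTrivial r-prime}}) r∣Q r⊥q²-1 (ℕ.>-nonZero⁻¹ (q ℕ.^ 2) {{qⁱ≢0 2}})
      divisor-of-x²-1-lifts divisor-of-x⁴-1-splits


module CubicCase (E : FiniteField) (q : ℕ) {p k : ℕ} (p-prime : Prime p) (q≡pᵏ : q ≡ p ℕ.^ k)
                 (order≡q³ : FiniteField.order E ≡ q ℕ.^ 3) (q%3≡2 : q ℕ.% 3 ≡ 2) where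
  open FiniteField E
  open FiniteFieldTheory E
  open Extension E q {p} {k} p-prime q≡pᵏ 3 order≡q³
  open Polynomials E q
  open DivisorReduction E q
  open CommutativeRing commutativeRing using (*-identityˡ; *-identityʳ; -‿inverseˡ; zeroˡ; _-_; ring)
  open Algebra.Properties.Ring ring using (-‿involutive)
  open ≡-Reasoning

  F-cube-root : ∀ {a} → InF E q a → a ^ 3 ≡ 1# → a ≡ 1#
  F-cube-root {a} a∈F a³≡1 = *-cancelˡ a≢0 (begin
    a * a               ≡⟨ cong (a *_) (sym (*-identityʳ a)) ⟩
    a ^ 2               ≡⟨ cong (a ^_) (sym q%3≡2) ⟩
    a ^ (q ℕ.% 3)       ≡⟨ sym (^-% 3 q a³≡1) ⟩
    a ^ q               ≡⟨ a∈F ⟩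
    a                   ≡⟨ sym (*-identityʳ a) ⟩
    a * 1# ∎)
    where
    a≢0 : a ≢ 0#
    a≢0 refl = 0≢1 (trans (sym (zeroˡ _)) a³≡1)

  F-cube-root-of-−1 : ∀ {a} → InF E q a → a * (a * a) ≡ - 1# → a ≡ - 1#
  F-cube-root-of-−1 {a} a∈F a³≡-1 =
    trans (sym (-‿involutive a)) (cong -_ (F-cube-root (-‿∈F a∈F) (begin
      (- a) ^ 3             ≡⟨ solve 1 (λ a → :- a :* (:- a :* (:- a :* :1)) := :- (a :* (a :* a))) refl a ⟩
      - (a * (a * a))       ≡⟨ cong -_ a³≡-1 ⟩
      - - 1#                ≡⟨ -‿involutive 1# ⟩
      1# ∎)))

  Hσ[x²+x+1]-fixed : HσFixedBy (q ℕ.^ 1) (1# ∷ 1# ∷ [])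
  Hσ[x²+x+1]-fixed v = begin
    Hσ E q (1# ∷ 1# ∷ []) v ^ (q ℕ.^ 1)          ≡⟨ Hσ-frobenius 1 (1# ∷ 1# ∷ []) (1∈F ∷ 1∈F ∷ []) v ⟩
    1# * V 1 + (1# * V 2 + (1# * V 3 + 0#))      ≡⟨ cong (λ x → 1# * V 1 + (1# * V 2 + (1# * x + 0#))) (fermat-qⁿ v) ⟩
    1# * V 1 + (1# * V 2 + (1# * v + 0#))        ≡⟨ solve 3 (λ v V₁ V₂ → :1 :* V₁ :+ (:1 :* V₂ :+ (:1 :* v :+ :0))
                                                             := :1 :* (v :* :1) :+ (:1 :* V₁ :+ (:1 :* V₂ :+ :0))) refl v (V 1) (V 2) ⟩
    Hσ E q (1# ∷ 1# ∷ []) v ∎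
    where V = λ i → v ^ (q ℕ.^ i)

  Hσ[x³-1]-fixed : HσFixedBy (q ℕ.^ 1) (- 1# ∷ 0# ∷ 0# ∷ [])
  Hσ[x³-1]-fixed v = trans (cong (_^ (q ℕ.^ 1)) Hσ≡0) (trans (0^n≡0 (q ℕ.^ 1) {{qⁱ≢0 1}}) (sym Hσ≡0))
    where
    V = λ i → v ^ (q ℕ.^ i)
    Hσ≡0 : Hσ E q (- 1# ∷ 0# ∷ 0# ∷ []) v ≡ 0#
    Hσ≡0 = begin
      - 1# * (v * 1#) + (0# * V 1 + (0# * V 2 + (1# * V 3 + 0#)))   ≡⟨ cong (λ x → - 1# * (v * 1#) + (0# * V 1 + (0# * V 2 + (1# * x + 0#)))) (fermat-qⁿ v) ⟩
      - 1# * (v * 1#) + (0# * V 1 + (0# * V 2 + (1# * v + 0#)))     ≡⟨ solve 3 (λ v V₁ V₂ → :- :1 :* (v :* :1) :+ (:0 :* V₁ :+ (:0 :* V₂ :+ (:1 :* v :+ :0))) := :0) refl v (V 1) (V 2) ⟩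
      0# ∎

  x-1∣x-1 : MonicDivides E q (- 1# ∷ []) (xⁿ-1 E q 1)
  x-1∣x-1 = 0 , [] , [] , Pointwise-≡⇒≡
    (solve 0 (:- :1 :* :1 :+ :0 := :- :1) refl ∷ solve 0 (:1 :* :1 :+ :0 := :1) refl ∷ [])

  linear-divisor-of-x³-1 : ∀ {a k₀ k₁} → InF E q a →
                           _*p_ E q (monic E q (a ∷ [])) (monic E q (k₀ ∷ k₁ ∷ [])) ≡ xⁿ-1 E q 3 →
                           MonicDivides E q (a ∷ []) (xⁿ-1 E q 1)
  linear-divisor-of-x³-1 {a} {k₀} {k₁} a∈F eq = subst (λ x → MonicDivides E q (x ∷ []) (xⁿ-1 E q 1)) (sym (F-cube-root-of-−1 a∈F a³≡-1)) x-1∣x-1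
    where
    c₀ : a * k₀ + 0# ≡ - 1#
    c₀ = cong (coefficient 0) eq
    c₁ : a * k₁ + (1# * k₀ + 0#) ≡ 0#
    c₁ = cong (coefficient 1) eq
    c₂ : a * 1# + 1# * k₁ ≡ 0#
    c₂ = cong (coefficient 2) eq
    a³≡-1 : a * (a * a) ≡ - 1#
    a³≡-1 = begin
      a * (a * a)
        ≡⟨ solve 3 (λ a k₀ k₁ → a :* (a :* a) := a :* a :* (a :* :1 :+ :1 :* k₁) :- a :* (a :* k₁ :+ (:1 :* k₀ :+ :0)) :+ (a :* k₀ :+ :0)) refl a k₀ k₁ ⟩
      a * a * (a * 1# + 1# * k₁) - a * (a * k₁ + (1# * k₀ + 0#)) + (a * k₀ + 0#)
        ≡⟨ cong₂ _+_ (cong₂ _-_ (cong (a * a *_) c₂) (cong (a *_) c₁)) c₀ ⟩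
      a * a * 0# - a * 0# + - 1#
        ≡⟨ solve 1 (λ a → a :* a :* :0 :- a :* :0 :+ :- :1 := :- :1) refl a ⟩
      - 1# ∎

  quadratic-divisor-of-x³-1 : ∀ {a₀ a₁ b} → InF E q b →
                              _*p_ E q (monic E q (a₀ ∷ a₁ ∷ [])) (monic E q (b ∷ [])) ≡ xⁿ-1 E q 3 →
                              HσFixedBy (q ℕ.^ 1) (a₀ ∷ a₁ ∷ [])
  quadratic-divisor-of-x³-1 {a₀} {a₁} {b} b∈F eq =
    subst₂ (λ x y → HσFixedBy (q ℕ.^ 1) (x ∷ y ∷ [])) (sym a₀≡1) (sym a₁≡1) Hσ[x²+x+1]-fixed
    where
    c₀ : a₀ * b + 0# ≡ - 1#
    c₀ = cong (coefficient 0) eq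
    c₁ : a₀ * 1# + (a₁ * b + 0#) ≡ 0#
    c₁ = cong (coefficient 1) eq
    c₂ : a₁ * 1# + (1# * b + 0#) ≡ 0#
    c₂ = cong (coefficient 2) eq
    b≡-1 : b ≡ - 1#
    b≡-1 = F-cube-root-of-−1 b∈F (begin
      b * (b * b)
        ≡⟨ solve 3 (λ a₀ a₁ b → b :* (b :* b) := b :* b :* (a₁ :* :1 :+ (:1 :* b :+ :0)) :- b :* (a₀ :* :1 :+ (a₁ :* b :+ :0)) :+ (a₀ :* b :+ :0)) refl a₀ a₁ b ⟩
      b * b * (a₁ * 1# + (1# * b + 0#)) - b * (a₀ * 1# + (a₁ * b + 0#)) + (a₀ * b + 0#)
        ≡⟨ cong₂ _+_ (cong₂ _-_ (cong (b * b *_) c₂) (cong (b *_) c₁)) c₀ ⟩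
      b * b * 0# - b * 0# + - 1#
        ≡⟨ solve 1 (λ b → b :* b :* :0 :- b :* :0 :+ :- :1 := :- :1) refl b ⟩
      - 1# ∎)
    a₁≡1 : a₁ ≡ 1#
    a₁≡1 = begin
      a₁                                  ≡⟨ solve 2 (λ a₁ b → a₁ := (a₁ :* :1 :+ (:1 :* b :+ :0)) :- b) refl a₁ b ⟩
      (a₁ * 1# + (1# * b + 0#)) - b       ≡⟨ cong₂ _-_ c₂ b≡-1 ⟩
      0# - - 1#                           ≡⟨ solve 0 (:0 :- :- :1 := :1) refl ⟩
      1# ∎
    a₀≡1 : a₀ ≡ 1#
    a₀≡1 = begin
      a₀                                  ≡⟨ solve 3 (λ a₀ a₁ b → a₀ := (a₀ :* :1 :+ (a₁ :* b :+ :0)) :- a₁ :* b) refl a₀ a₁ b ⟩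
      (a₀ * 1# + (a₁ * b + 0#)) - a₁ * b  ≡⟨ cong₂ _-_ c₁ (cong₂ _*_ a₁≡1 b≡-1) ⟩
      0# - 1# * - 1#                      ≡⟨ solve 0 (:0 :- :1 :* :- :1 := :1) refl ⟩
      1# ∎

  cubic-divisor-of-x³-1 : ∀ {a₀ a₁ a₂} →
                          _*p_ E q (monic E q (a₀ ∷ a₁ ∷ a₂ ∷ [])) (monic E q []) ≡ xⁿ-1 E q 3 →
                          HσFixedBy (q ℕ.^ 1) (a₀ ∷ a₁ ∷ a₂ ∷ [])
  cubic-divisor-of-x³-1 {a₀} {a₁} {a₂} eq = subst (HσFixedBy (q ℕ.^ 1))
    (sym (cong₂ Vec._∷_ (trans (unit a₀) (cong (coefficient 0) eq)) (cong₂ Vec._∷_ (trans (unit a₁) (cong (coefficient 1) eq))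
         (cong (Vec._∷ []) (trans (unit a₂) (cong (coefficient 2) eq))))))
    Hσ[x³-1]-fixed
    where
    unit : ∀ a → a ≡ a * 1# + 0#
    unit a = solve 1 (λ a → a := a :* :1 :+ :0) refl a

  divisor-of-x³-1-splits : ∀ {d} (cs : Vec Carrier (suc d)) → MonicFDivisor (xⁿ-1 E q 3) cs →
                           MonicDivides E q cs (xⁿ-1 E q 1) ⊎ HσFixedBy (q ℕ.^ 1) cs
  divisor-of-x³-1-splits cs (cs∈F , _ , ks , ks∈F , eq) =
    by-degree cs ks cs∈F ks∈F (ℕ.suc-injective (ℕ.suc-injective (degrees-of-factors cs ks eq))) eq
    where
    by-degree : ∀ {d e} (cs : Vec Carrier (suc d)) (ks : Vec Carrier e) → MonicF E q cs → MonicF E q ks →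
                d ℕ.+ e ≡ 2 → _*p_ E q (monic E q cs) (monic E q ks) ≡ xⁿ-1 E q 3 →
                MonicDivides E q cs (xⁿ-1 E q 1) ⊎ HσFixedBy (q ℕ.^ 1) cs
    by-degree {0} (_ ∷ []) (_ ∷ _ ∷ []) (a∈F ∷ []) _ refl eq = inj₁ (linear-divisor-of-x³-1 a∈F eq)
    by-degree {1} (_ ∷ _ ∷ []) (_ ∷ []) _ (b∈F ∷ []) refl eq = inj₂ (quadratic-divisor-of-x³-1 b∈F eq)
    by-degree {2} (_ ∷ _ ∷ _ ∷ []) [] _ _ refl eq = inj₂ (cubic-divisor-of-x³-1 eq)
    by-degree {suc (suc (suc _))} _ _ _ _ () _

  -- A divisor of positive degree of x - 1 is x - 1 itself, with cofactor x² + x + 1 in x³ - 1.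
  divisor-of-x-1-lifts : ∀ {d} (cs : Vec Carrier (suc d)) → MonicFDivisor (xⁿ-1 E q 1) cs → MonicDivides E q cs (xⁿ-1 E q 3)
  divisor-of-x-1-lifts cs (_ , _ , ks , _ , eq) = by-degree cs ks (ℕ.suc-injective (ℕ.suc-injective (degrees-of-factors cs ks eq))) eq
    where
    by-degree : ∀ {d e} (cs : Vec Carrier (suc d)) (ks : Vec Carrier e) →
                d ℕ.+ e ≡ 0 → _*p_ E q (monic E q cs) (monic E q ks) ≡ xⁿ-1 E q 1 → MonicDivides E q cs (xⁿ-1 E q 3)
    by-degree {0} (a ∷ []) [] refl eq = 2 , 1# ∷ 1# ∷ [] , 1∈F ∷ 1∈F ∷ [] ,
      Pointwise-≡⇒≡ (c₀ ∷ d₁ ∷ d₂ ∷ *-identityˡ 1# ∷ [])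
      where
      c₀ : a * 1# + 0# ≡ - 1#
      c₀ = cong (coefficient 0) eq
      d₁ : a * 1# + (1# * 1# + 0#) ≡ 0#
      d₁ = begin
        a * 1# + (1# * 1# + 0#)   ≡⟨ solve 1 (λ a → a :* :1 :+ (:1 :* :1 :+ :0) := (a :* :1 :+ :0) :+ :1) refl a ⟩
        (a * 1# + 0#) + 1#        ≡⟨ cong (_+ 1#) c₀ ⟩
        - 1# + 1#                 ≡⟨ -‿inverseˡ 1# ⟩
        0# ∎
      d₂ : a * 1# + 1# * 1# ≡ 0#
      d₂ = trans (solve 1 (λ a → a :* :1 :+ :1 :* :1 := a :* :1 :+ (:1 :* :1 :+ :0)) refl a) d₁

  N[Q,x³-1,x³-1]≡N[Q,x-1,x-1] :
    SameN E q (Qnum q 3) (xⁿ-1 E q 3) (xⁿ-1 E q 3) (Qnum q 3) (xⁿ-1 E q 1) (xⁿ-1 E q 1)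
  N[Q,x³-1,x³-1]≡N[Q,x-1,x-1] =
    let (r , r-prime , r∣Q , r⊥q-1) = Qnum-prime-factor-3 q q%3≡2 in
    sameN-reduction (Qnum q 3) {{Qnum≢0 q 3}} (xⁿ-1 E q 3) (xⁿ-1 E q 1) (q ℕ.^ 1)
      (ℕ.nonTrivial⇒≢1 {{prime⇒nonTrivial r-prime}}) r∣Q r⊥q-1 (ℕ.>-nonZero⁻¹ (q ℕ.^ 1) {{qⁱ≢0 1}})
      divisor-of-x-1-lifts divisor-of-x³-1-splits

-- Opened only here: inside the modules above, _^_ is the power of the field E.
open import Data.Nat using (_%_; _^_)

lemma2p5 : ∀ (q : ℕ) → IsPrimePower q →
    ((q % 4 ≡ 3) → ∀ (E : FiniteField) → FiniteField.order E ≡ q ^ 4 →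
       SameN E q (Qnum q 4) (xⁿ-1 E q 4) (xⁿ-1 E q 4) (Qnum q 4) (xⁿ-1 E q 2) (xⁿ-1 E q 2))
    × ((q % 3 ≡ 2) → ∀ (E : FiniteField) → FiniteField.order E ≡ q ^ 3 →
       SameN E q (Qnum q 3) (xⁿ-1 E q 3) (xⁿ-1 E q 3) (Qnum q 3) (xⁿ-1 E q 1) (xⁿ-1 E q 1))
lemma2p5 q (p , k , p-prime , _ , q≡pᵏ) =
  (λ q%4≡3 E order≡q⁴ → QuarticCase.N[Q,x⁴-1,x⁴-1]≡N[Q,x²-1,x²-1] E q {p} {k} p-prime q≡pᵏ order≡q⁴ q%4≡3) ,
  (λ q%3≡2 E order≡q³ → CubicCase.N[Q,x³-1,x³-1]≡N[Q,x-1,x-1] E q {p} {k} p-prime q≡pᵏ order≡q³ q%3≡2)
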